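{- For every $n$ and all $1\le i<j\le n-1$ with $j-i>1$, the operators $\tau_i,\tau_j:V(n)\to V(n)$ satisfy $\tau_i\tau_j=\tau_j\tau_i$.
   Context: $[n]=\{1,\dots,n\}$, $s_i=(i,i+1)\in\mathfrak{S}_n$. For $w\in\mathfrak{S}_n$ and a set partition $\pi$ of $[n]$, $w(\pi)$ is the set partition in which $w(a),w(b)$ share a block iff $a,b$ share a block of $\pi$; $B_i(\pi)$ is the block of $\pi$ containing $i$. A set partition is noncrossing if whenever $a<b<c<d$ with $a,c$ in one block and $b,d$ in one block, all four are in the same block; $NC(n)$ is the set of noncrossing partitions of $[n]$. A set partition $\pi$ is almost noncrossing if it is not noncrossing but $s_i(\pi)$ is noncrossing for some $i$; then $\pi$ crosses at $i$. Skein map: for $\pi$ almost noncrossing crossing at $i$, write $B_i(\pi)=\{i,a_1,\dots,a_k\}$, $B_{i+1}(\pi)=\{i+1,b_1,\dots,b_\ell\}$ ($k,\ell\ge1$); let $\pi_1=s_i(\pi)$ and let $\pi_2,\pi_3,\pi_4$ be obtained from $\pi$ by replacing $B_i(\pi),B_{i+1}(\pi)$ by $\{i,i+1\},\{a_1..a_k,b_1..b_\ell\}$ (for $\pi_2$), $\{i,i+1,a_1..a_k\},\{b_1..b_\ell\}$ (for $\pi_3$), $\{i,i+1,b_1..b_\ell\},\{a_1..a_k\}$ (for $\pi_4$). Then $\sigma(\pi)=\pi_1+\pi_2-\pi_3-\pi_4$ if $k,\ell\ge2$, with the $\pi_3$ term deleted if $\ell=1$ and the $\pi_4$ term deleted if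 $k=1$; this is a linear combination of noncrossing partitions, independent of the chosen crossing index. $V(n)$ is the $\mathbb{Q}$-vector space with basis $NC(n)$. For $1\le i\le n-1$, $\tau_i$ is the linear operator on $V(n)$ defined on $\pi\in NC(n)$ by: $\tau_i(\pi)=s_i(\pi)$ if $s_i(\pi)$ is noncrossing and $B_i(\pi)\ne B_{i+1}(\pi)$; $\tau_i(\pi)=-\pi$ if $B_i(\pi)=B_{i+1}(\pi)$; $\tau_i(\pi)=\sigma(s_i(\pi))$ if $s_i(\pi)$ is not noncrossing (then it is almost noncrossing, crossing at $i$). -}

module Defs where

open import Data.Nat using (ℕ; zero; suc; _<_; _≤_; _≡ᵇ_; _<ᵇ_; _≤ᵇ_)
open import Data.Bool using (Bool; true; false; _∧_; _∨_; not; _xor_; if_then_else_)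
open import Data.List using (List; []; _∷_; _++_; map; upTo; concatMap; foldr)
open import Data.Rational using (ℚ; 0ℚ; 1ℚ; -_; _+_; _*_)
open import Data.Product using (_×_; _,_; proj₁; proj₂)
open import Relation.Binary.PropositionalEquality using (_≡_)

-- Set partitions of [n] = {1,…,n} (1-based, elements are naturals).
-- A set partition is represented by its "same block" relation
-- R a b = true  iff  a and b lie in the same block.
-- Only the values of R on [n] × [n] are meaningful.

Rel : Set
Rel = ℕ → ℕ → Bool

InN : ℕ → ℕ → Set
InN n a = (1 ≤ a) × (a ≤ n)

record IsSetPartition (n : ℕ) (R : Rel) : Set where
  field
    reflP  : ∀ a → InN n a → R a a ≡ true
    symP   : ∀ a b → InN n a → InN n b → R a b ≡ true → R b a ≡ true
    transP : ∀ a b c → InN n a → InN n b → InN n c →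
             R a b ≡ true → R b c ≡ true → R a c ≡ true

IsNoncrossing : ℕ → Rel → Set
IsNoncrossing n R = ∀ a b c d → InN n a → InN n b → InN n c → InN n d →
  a < b → b < c → c < d → R a c ≡ true → R b d ≡ true →
  (R a b ≡ true) × (R a d ≡ true) × (R c b ≡ true)

IsNC : ℕ → Rel → Set
IsNC n R = IsSetPartition n R × IsNoncrossing n R

all : {A : Set} → (A → Bool) → List A → Bool
all p = foldr (λ x acc → p x ∧ acc) true

range : ℕ → List ℕ
range n = map suc (upTo n)

ncᵇ : ℕ → Rel → Bool
ncᵇ n R = all (λ a → all (λ b → all (λ c → all (λ d →
    not ((a <ᵇ b) ∧ (b <ᵇ c) ∧ (c <ᵇ d) ∧ R a c ∧ R b d)
    ∨ (R a b ∧ R a d ∧ R c b))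
  (range n)) (range n)) (range n)) (range n)

boolEq : Bool → Bool → Bool
boolEq x y = not (x xor y)

sameᵇ : ℕ → Rel → Rel → Bool
sameᵇ n R S = all (λ a → all (λ b → boolEq (R a b) (S a b)) (range n)) (range n)

swp : ℕ → ℕ → ℕ
swp i m = if m ≡ᵇ i then suc i else (if m ≡ᵇ suc i then i else m)

-- s_i(π): s_i(a), s_i(b) share a block iff a, b do; s_i is an involution
act : ℕ → Rel → Rel
act i R a b = R (swp i a) (swp i b)

-- The skein map σ at crossing index i.
-- For ρ with B_i(ρ) = {i} ∪ A, B_{i+1}(ρ) = {i+1} ∪ B, classify elements.

data Cls : Set where
  cI cI' cA cB cO : Cls

cls : ℕ → Rel → ℕ → Cls
cls i ρ x = if x ≡ᵇ i then cI else (if x ≡ᵇ suc i then cI' else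
            (if ρ i x then cA else (if ρ (suc i) x then cB else cO)))

-- replace B_i(ρ), B_{i+1}(ρ) by the blocks given by the labelling g of
-- {i}, {i+1}, A, B (same label = same new block); other blocks unchanged
regroup : (Cls → ℕ) → ℕ → Rel → Rel
regroup g i ρ x y with cls i ρ x | cls i ρ y
... | cO | cO = ρ x y
... | cO | _  = false
... | _  | cO = false
... | cx | cy = g cx ≡ᵇ g cy

-- π₂ : {i,i+1}, A ∪ B
g₂ : Cls → ℕ
g₂ cI = 0
g₂ cI' = 0
g₂ _ = 1

-- π₃ : {i,i+1} ∪ A, B
g₃ : Cls → ℕ
g₃ cB = 1
g₃ _ = 0

-- π₄ : {i,i+1} ∪ B, A
g₄ : Cls → ℕ
g₄ cA = 1
g₄ _ = 0

count : (ℕ → Bool) → List ℕ → ℕ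
count p = foldr (λ x acc → if p x then suc acc else acc) 0

-- formal Q-linear combinations of partitions (elements of V(n))
Comb : Set
Comb = List (ℚ × Rel)

-- σ(ρ) for ρ almost noncrossing, crossing at i (ρ a partition of [n])
σ : ℕ → ℕ → Rel → Comb
σ n i ρ =
  (1ℚ , act i ρ) ∷ (1ℚ , regroup g₂ i ρ) ∷
  ((if 2 ≤ᵇ ℓ then (- 1ℚ , regroup g₃ i ρ) ∷ [] else []) ++
   (if 2 ≤ᵇ k then (- 1ℚ , regroup g₄ i ρ) ∷ [] else []))
  where
    k = count (λ x → ρ i x ∧ not (x ≡ᵇ i)) (range n)
    ℓ = count (λ x → ρ (suc i) x ∧ not (x ≡ᵇ suc i)) (range n)

τbasis : ℕ → ℕ → Rel → Comb
τbasis n i π =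
  if π i (suc i) then (- 1ℚ , π) ∷ []
  else (if ncᵇ n (act i π) then (1ℚ , act i π) ∷ []
        else σ n i (act i π))

scale : ℚ → Comb → Comb
scale q = map (λ p → (q * proj₁ p , proj₂ p))

τ : ℕ → ℕ → Comb → Comb
τ n i = concatMap (λ p → scale (proj₁ p) (τbasis n i (proj₂ p)))

coeff : ℕ → Comb → Rel → ℚ
coeff n v π = foldr (λ p acc → if sameᵇ n (proj₂ p) π then proj₁ p + acc else acc) 0ℚ v

-- τᵢ and τⱼ with j − i > 1 only look at π through the blocks of the four anchors i, i+1, j, j+1.
-- Label each anchor by itself and every other element of [n] by the first anchor whose block
-- contains it (a rest label), leaving the remaining elements unlabelled. Every partition occurring
-- in τᵢτⱼ(π) or τⱼτᵢ(π) then agrees with π on unlabelled elements and glues the labelled ones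
-- according to an 8 × 8 table on labels, on which τᵢ and τⱼ act by explicit finite operations.
-- Two facts about a noncrossing π make this work: when k ≁ k+1, s_k(π) is noncrossing iff the
-- block of k or of k+1 is a singleton, and all skein terms are again noncrossing, so τᵢ may be
-- applied to the output of τⱼ. Only whether each rest label is carried by no, one or several
-- elements matters, so the commutation reduces to the 15 partitions of the anchors times 3⁴ size
-- patterns, which are checked by evaluation; linearity extends the identity from NC(n) to V(n).

module Submission where

open import Defs
open import Data.Nat using (ℕ; _<_; _≤_; _∸_)
open import Data.Product using (proj₂)
open import Data.List.Relation.Unary.All using (All)
open import Relation.Binary.PropositionalEquality using (_≡_)

open import Data.Nat
  using (zero; suc; _≡ᵇ_; _<ᵇ_; _≤ᵇ_; z≤n; s≤s)
open import Data.Nat.Properties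
open import Data.Bool using (Bool; true; false; _∧_; _∨_; not; _xor_; if_then_else_)
open import Data.List using (List; []; _∷_; _++_; map; concatMap; foldr)
open import Data.Nat.ListAction using (sum)
open import Data.List.Membership.Propositional using (_∈_)
open import Data.List.Membership.Propositional.Properties using (∈-map⁺; ∈-map⁻; ∈-upTo⁺; ∈-upTo⁻)
open import Data.List.Relation.Unary.Any using (here; there)
open import Data.List.Relation.Unary.All using ([]; _∷_)
open import Data.List.Relation.Unary.All.Properties using (++⁺)
open import Data.List.Relation.Unary.Unique.Propositional using (Unique)
open import Data.List.Relation.Unary.AllPairs using ([]; _∷_)
import Data.List.Relation.Unary.All as All
import Data.List.Relation.Unary.Unique.Propositional.Properties as Unique
open import Data.Product using (∃-syntax; _×_; _,_; proj₁)
open import Data.Sum using (_⊎_; inj₁; inj₂)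
open import Data.Empty using (⊥; ⊥-elim)
open import Function using (_∘_; Equivalence)
open import Data.Maybe using (Maybe; just; nothing; maybe′)
open import Data.Rational using (ℚ)
import Data.Maybe
open import Data.Bool.Properties using (T-≡)
open import Relation.Nullary using (¬_; yes; no)
open import Relation.Binary.Definitions using (Tri; tri<; tri≈; tri>)
open import Relation.Binary.PropositionalEquality
  using (_≢_; refl; sym; trans; cong; cong₂; subst; subst₂; module ≡-Reasoning)

true≢false : true ≢ false
true≢false ()

∧-true⇒ˡ : ∀ {a b} → a ∧ b ≡ true → a ≡ true
∧-true⇒ˡ {true} _ = refl

∧-true⇒ʳ : ∀ {a b} → a ∧ b ≡ true → b ≡ true
∧-true⇒ʳ {true} e = e

∧-true : ∀ {a b} → a ≡ true → b ≡ true → a ∧ b ≡ true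
∧-true refl refl = refl

not-true⇒false : ∀ {b} → not b ≡ true → b ≡ false
not-true⇒false {false} _ = refl

xor-true⇒≡not : ∀ a b → (a xor b) ≡ true → b ≡ not a
xor-true⇒≡not true false _ = refl
xor-true⇒≡not false true _ = refl

≡ᵇ-refl : ∀ m → (m ≡ᵇ m) ≡ true
≡ᵇ-refl zero = refl
≡ᵇ-refl (suc m) = ≡ᵇ-refl m

≡ᵇ-true⇒≡ : ∀ {m n} → (m ≡ᵇ n) ≡ true → m ≡ n
≡ᵇ-true⇒≡ {m} {n} e = ≡ᵇ⇒≡ m n (Equivalence.from T-≡ e)

≢⇒≡ᵇ-false : ∀ {m n} → m ≢ n → (m ≡ᵇ n) ≡ false
≢⇒≡ᵇ-false {m} {n} m≢n with m ≡ᵇ n in e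
... | true = ⊥-elim (m≢n (≡ᵇ-true⇒≡ e))
... | false = refl

≡ᵇ-false⇒≢ : ∀ {m n} → (m ≡ᵇ n) ≡ false → m ≢ n
≡ᵇ-false⇒≢ {m} e refl = true≢false (trans (sym (≡ᵇ-refl m)) e)

<⇒<ᵇ-true : ∀ {m n} → m < n → (m <ᵇ n) ≡ true
<⇒<ᵇ-true m<n = Equivalence.to T-≡ (<⇒<ᵇ m<n)

<ᵇ-true⇒< : ∀ {m n} → (m <ᵇ n) ≡ true → m < n
<ᵇ-true⇒< {m} {n} e = <ᵇ⇒< m n (Equivalence.from T-≡ e)

<ᵇ-false⇒≥ : ∀ {m n} → (m <ᵇ n) ≡ false → n ≤ m
<ᵇ-false⇒≥ e = ≮⇒≥ (λ m<n → true≢false (trans (sym (<⇒<ᵇ-true m<n)) e))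

≤⇒≤ᵇ-true : ∀ {m n} → m ≤ n → (m ≤ᵇ n) ≡ true
≤⇒≤ᵇ-true m≤n = Equivalence.to T-≡ (≤⇒≤ᵇ m≤n)

≤ᵇ-true⇒≤ : ∀ {m n} → (m ≤ᵇ n) ≡ true → m ≤ n
≤ᵇ-true⇒≤ {m} {n} e = ≤ᵇ⇒≤ m n (Equivalence.from T-≡ e)

bool-ext : ∀ {a b} → (a ≡ true → b ≡ true) → (b ≡ true → a ≡ true) → a ≡ b
bool-ext {true} {true} _ _ = refl
bool-ext {true} {false} f _ = sym (f refl)
bool-ext {false} {true} _ g = g refl
bool-ext {false} {false} _ _ = refl

module _ {A : Set} where

  all-sound : ∀ (p : A → Bool) {xs x} → all p xs ≡ true → x ∈ xs → p x ≡ true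
  all-sound p e (here refl) = ∧-true⇒ˡ e
  all-sound p {y ∷ _} e (there x∈) = all-sound p (∧-true⇒ʳ {p y} e) x∈

  all-complete : ∀ (p : A → Bool) xs → (∀ {x} → x ∈ xs → p x ≡ true) → all p xs ≡ true
  all-complete p [] _ = refl
  all-complete p (x ∷ xs) h = ∧-true (h (here refl)) (all-complete p xs (h ∘ there))

  all-cong : ∀ (p q : A → Bool) xs → (∀ {x} → x ∈ xs → p x ≡ q x) → all p xs ≡ all q xs
  all-cong p q [] _ = refl
  all-cong p q (x ∷ xs) h = cong₂ _∧_ (h (here refl)) (all-cong p q xs (h ∘ there))

count-cong : ∀ (p q : ℕ → Bool) xs → (∀ {x} → x ∈ xs → p x ≡ q x) → count p xs ≡ count q xs
count-cong p q [] _ = refl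
count-cong p q (x ∷ xs) h rewrite h (here refl) | count-cong p q xs (h ∘ there) = refl

count-pos⇒witness : ∀ (p : ℕ → Bool) xs → 1 ≤ count p xs → ∃[ x ] x ∈ xs × p x ≡ true
count-pos⇒witness p (x ∷ xs) pos with p x in px
... | true = x , here refl , px
... | false with count-pos⇒witness p xs pos
... | y , y∈ , py = y , there y∈ , py

witness⇒count-pos : ∀ (p : ℕ → Bool) {xs x} → x ∈ xs → p x ≡ true → 1 ≤ count p xs
witness⇒count-pos p {x ∷ _} (here refl) px rewrite px = s≤s z≤n
witness⇒count-pos p {y ∷ xs} (there x∈) px with p y
... | true = s≤s z≤n
... | false = witness⇒count-pos p x∈ px

count-none : ∀ (p : ℕ → Bool) xs → (∀ {x} → x ∈ xs → p x ≡ false) → count p xs ≡ 0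
count-none p [] _ = refl
count-none p (x ∷ xs) h rewrite h (here refl) = count-none p xs (h ∘ there)

count-≡ᵇ-unique : ∀ {xs y} → Unique xs → y ∈ xs → count (_≡ᵇ y) xs ≡ 1
count-≡ᵇ-unique {y ∷ xs} (y∉xs ∷ _) (here refl) rewrite ≡ᵇ-refl y =
  cong suc (count-none (_≡ᵇ y) xs (λ x∈ → ≢⇒≡ᵇ-false (λ x≡y → All.lookup y∉xs x∈ (sym x≡y))))
count-≡ᵇ-unique {z ∷ xs} {y} (z∉xs ∷ u) (there y∈)
  rewrite ≢⇒≡ᵇ-false {z} {y} (λ z≡y → All.lookup z∉xs y∈ z≡y) = count-≡ᵇ-unique u y∈

∈-range⁻ : ∀ {n x} → x ∈ range n → InN n x
∈-range⁻ x∈ with ∈-map⁻ suc x∈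
... | y , y∈ , refl = s≤s z≤n , ∈-upTo⁻ y∈

∈-range⁺ : ∀ {n x} → InN n x → x ∈ range n
∈-range⁺ {x = suc y} (_ , y<n) = ∈-map⁺ suc (∈-upTo⁺ y<n)

range-unique : ∀ n → Unique (range n)
range-unique n = Unique.map⁺ suc-injective (Unique.upTo⁺ n)

suc≢ : ∀ k → suc k ≢ k
suc≢ k e = <-irrefl (sym e) (n<1+n k)

swp-left : ∀ k → swp k k ≡ suc k
swp-left k rewrite ≡ᵇ-refl k = refl

swp-right : ∀ k → swp k (suc k) ≡ k
swp-right k rewrite ≢⇒≡ᵇ-false (suc≢ k) | ≡ᵇ-refl k = refl

swp-other : ∀ k {x} → x ≢ k → x ≢ suc k → swp k x ≡ x
swp-other k x≢k x≢k+1 rewrite ≢⇒≡ᵇ-false x≢k | ≢⇒≡ᵇ-false x≢k+1 = refl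

swp-involutive : ∀ k x → swp k (swp k x) ≡ x
swp-involutive k x with x ≟ k | x ≟ suc k
... | yes refl | _ rewrite swp-left x = swp-right x
... | no _ | yes refl rewrite swp-right k = swp-left k
... | no x≢k | no x≢k+1 rewrite swp-other k x≢k x≢k+1 = swp-other k x≢k x≢k+1

swp-inN : ∀ {n k x} → 1 ≤ k → suc k ≤ n → InN n x → InN n (swp k x)
swp-inN {k = k} {x} 1≤k k<n x∈ with x ≟ k | x ≟ suc k
... | yes refl | _ rewrite swp-left x = s≤s z≤n , k<n
... | no _ | yes refl rewrite swp-right k = 1≤k , ≤-trans (n≤1+n k) k<n
... | no x≢k | no x≢k+1 rewrite swp-other k x≢k x≢k+1 = x∈

swp-monoˡ : ∀ k {x y} → x ≢ suc k → y ≢ suc k → x < y → swp k x < swp k y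
swp-monoˡ k {x} {y} x≢k+1 y≢k+1 x<y with x ≟ k | y ≟ k
... | yes refl | _ rewrite swp-left x | swp-other x (λ e → <-irrefl (sym e) x<y) y≢k+1 =
  ≤∧≢⇒< x<y (y≢k+1 ∘ sym)
... | no x≢k | yes refl rewrite swp-other k x≢k x≢k+1 | swp-left y = <-trans x<y (n<1+n y)
... | no x≢k | no y≢k rewrite swp-other k x≢k x≢k+1 | swp-other k y≢k y≢k+1 = x<y

swp-monoʳ : ∀ k {x y} → x ≢ k → y ≢ k → x < y → swp k x < swp k y
swp-monoʳ k {x} {y} x≢k y≢k x<y with y ≟ suc k | x ≟ suc k
... | yes refl | _ rewrite swp-right k | swp-other k x≢k (λ e → <-irrefl e x<y) = ≤∧≢⇒< (≤-pred x<y) x≢k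
... | no y≢k+1 | yes refl rewrite swp-other k y≢k y≢k+1 | swp-right k = <-trans (n<1+n k) x<y
... | no y≢k+1 | no x≢k+1 rewrite swp-other k x≢k x≢k+1 | swp-other k y≢k y≢k+1 = x<y

swp≡left⇒ : ∀ k {y} → swp k y ≡ k → y ≡ suc k
swp≡left⇒ k {y} e = trans (sym (swp-involutive k y)) (trans (cong (swp k) e) (swp-left k))

swp≡right⇒ : ∀ k {y} → swp k y ≡ suc k → y ≡ k
swp≡right⇒ k {y} e = trans (sym (swp-involutive k y)) (trans (cong (swp k) e) (swp-right k))

companions : ℕ → Rel → ℕ → ℕ
companions n R p = count (λ x → R p x ∧ not (x ≡ᵇ p)) (range n)

some-companion : ∀ n R p → (1 ≤ᵇ companions n R p) ≡ true → ∃[ x ] InN n x × x ≢ p × R p x ≡ true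
some-companion n R p e with count-pos⇒witness _ (range n) (≤ᵇ-true⇒≤ e)
... | x , x∈ , Rpx∧x≢p =
  x , ∈-range⁻ x∈ , ≡ᵇ-false⇒≢ (not-true⇒false (∧-true⇒ʳ {R p x} Rpx∧x≢p)) , ∧-true⇒ˡ Rpx∧x≢p

no-companion : ∀ n R p → (1 ≤ᵇ companions n R p) ≡ false → ∀ {x} → InN n x → x ≢ p → R p x ≡ false
no-companion n R p e {x} x∈ x≢p with R p x in Rpx
... | false = refl
... | true = ⊥-elim (true≢false (trans (sym (≤⇒≤ᵇ-true (witness⇒count-pos _ (∈-range⁺ x∈) companion))) e))
  where
  companion : R p x ∧ not (x ≡ᵇ p) ≡ true
  companion rewrite Rpx | ≢⇒≡ᵇ-false x≢p = refl

quadOK : Rel → ℕ → ℕ → ℕ → ℕ → Bool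
quadOK R a b c d =
  not ((a <ᵇ b) ∧ (b <ᵇ c) ∧ (c <ᵇ d) ∧ R a c ∧ R b d) ∨ (R a b ∧ R a d ∧ R c b)

ncᵇ-sound : ∀ n R → ncᵇ n R ≡ true → IsNoncrossing n R
ncᵇ-sound n R e a b c d a∈ b∈ c∈ d∈ a<b b<c c<d Rac Rbd
  with all-sound _ (all-sound _ (all-sound _ (all-sound _ e (∈-range⁺ a∈))
         (∈-range⁺ b∈)) (∈-range⁺ c∈)) (∈-range⁺ d∈)
... | ok rewrite <⇒<ᵇ-true a<b | <⇒<ᵇ-true b<c | <⇒<ᵇ-true c<d | Rac | Rbd =
  ∧-true⇒ˡ ok , ∧-true⇒ˡ (∧-true⇒ʳ {R a b} ok) , ∧-true⇒ʳ {R a d} (∧-true⇒ʳ {R a b} ok)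

quadOK-complete : ∀ R a b c d →
  (a < b → b < c → c < d → R a c ≡ true → R b d ≡ true →
   (R a b ≡ true) × (R a d ≡ true) × (R c b ≡ true)) →
  quadOK R a b c d ≡ true
quadOK-complete R a b c d h
  with a <ᵇ b in ab | b <ᵇ c in bc | c <ᵇ d in cd | R a c | R b d
... | false | _ | _ | _ | _ = refl
... | true | false | _ | _ | _ = refl
... | true | true | false | _ | _ = refl
... | true | true | true | false | _ = refl
... | true | true | true | true | false = refl
... | true | true | true | true | true
  with h (<ᵇ-true⇒< ab) (<ᵇ-true⇒< bc) (<ᵇ-true⇒< cd) refl refl
... | Rab , Rad , Rcb rewrite Rab | Rad | Rcb = refl

ncᵇ-complete : ∀ n R → IsNoncrossing n R → ncᵇ n R ≡ true
ncᵇ-complete n R nc =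
  all-complete _ _ λ a∈ → all-complete _ _ λ b∈ → all-complete _ _ λ c∈ → all-complete _ _ λ d∈ →
    quadOK-complete R _ _ _ _ (nc _ _ _ _ (∈-range⁻ a∈) (∈-range⁻ b∈) (∈-range⁻ c∈) (∈-range⁻ d∈))

crossing⇒ncᵇ-false : ∀ n R {a b c d} → InN n a → InN n b → InN n c → InN n d →
  a < b → b < c → c < d → R a c ≡ true → R b d ≡ true → R a b ≡ false → ncᵇ n R ≡ false
crossing⇒ncᵇ-false n R {a} {b} {c} {d} a∈ b∈ c∈ d∈ a<b b<c c<d Rac Rbd Rab
  with ncᵇ n R in e
... | false = refl
... | true = ⊥-elim (true≢false (trans (sym (proj₁ (ncᵇ-sound n R e a b c d a∈ b∈ c∈ d∈ a<b b<c c<d Rac Rbd))) Rab))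

_≈[_]_ : Rel → ℕ → Rel → Set
R ≈[ n ] S = ∀ {x y} → InN n x → InN n y → R x y ≡ S x y

IsNC-resp-≈ : ∀ {n R S} → R ≈[ n ] S → IsNC n R → IsNC n S
IsNC-resp-≈ {n} {R} {S} R≈S (part , nc) = part′ , nc′
  where
  open IsSetPartition part
  ⇒S : ∀ {x y} → InN n x → InN n y → R x y ≡ true → S x y ≡ true
  ⇒S x∈ y∈ e = trans (sym (R≈S x∈ y∈)) e
  ⇒R : ∀ {x y} → InN n x → InN n y → S x y ≡ true → R x y ≡ true
  ⇒R x∈ y∈ e = trans (R≈S x∈ y∈) e
  part′ : IsSetPartition n S
  part′ = record
    { reflP = λ a a∈ → ⇒S a∈ a∈ (reflP a a∈)
    ; symP = λ a b a∈ b∈ e → ⇒S b∈ a∈ (symP a b a∈ b∈ (⇒R a∈ b∈ e))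
    ; transP = λ a b c a∈ b∈ c∈ e e′ → ⇒S a∈ c∈ (transP a b c a∈ b∈ c∈ (⇒R a∈ b∈ e) (⇒R b∈ c∈ e′)) }
  nc′ : IsNoncrossing n S
  nc′ a b c d a∈ b∈ c∈ d∈ a<b b<c c<d Sac Sbd
    with nc a b c d a∈ b∈ c∈ d∈ a<b b<c c<d (⇒R a∈ c∈ Sac) (⇒R b∈ d∈ Sbd)
  ... | Rab , Rad , Rcb = ⇒S a∈ b∈ Rab , ⇒S a∈ d∈ Rad , ⇒S c∈ b∈ Rcb

rejoin : (Cls → ℕ) → Cls → Cls → Bool → Bool
rejoin g cO cO b = b
rejoin g cO _ b = false
rejoin g _ cO b = false
rejoin g c d b = g c ≡ᵇ g d

regroup≡rejoin : ∀ g i ρ x y → regroup g i ρ x y ≡ rejoin g (cls i ρ x) (cls i ρ y) (ρ x y)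
regroup≡rejoin g i ρ x y with cls i ρ x | cls i ρ y
... | cI  | cI  = refl
... | cI  | cI' = refl
... | cI  | cA  = refl
... | cI  | cB  = refl
... | cI  | cO  = refl
... | cI' | cI  = refl
... | cI' | cI' = refl
... | cI' | cA  = refl
... | cI' | cB  = refl
... | cI' | cO  = refl
... | cA  | cI  = refl
... | cA  | cI' = refl
... | cA  | cA  = refl
... | cA  | cB  = refl
... | cA  | cO  = refl
... | cB  | cI  = refl
... | cB  | cI' = refl
... | cB  | cA  = refl
... | cB  | cB  = refl
... | cB  | cO  = refl
... | cO  | cI  = refl
... | cO  | cI' = refl
... | cO  | cA  = refl
... | cO  | cB  = refl
... | cO  | cO  = refl

rejoin-unmovedˡ : ∀ g c b → (c ≡ cO → b ≡ false) → rejoin g cO c b ≡ false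
rejoin-unmovedˡ g cI b _ = refl
rejoin-unmovedˡ g cI' b _ = refl
rejoin-unmovedˡ g cA b _ = refl
rejoin-unmovedˡ g cB b _ = refl
rejoin-unmovedˡ g cO b h = h refl

rejoin-unmovedʳ : ∀ g c b → (c ≡ cO → b ≡ false) → rejoin g c cO b ≡ false
rejoin-unmovedʳ g cI b _ = refl
rejoin-unmovedʳ g cI' b _ = refl
rejoin-unmovedʳ g cA b _ = refl
rejoin-unmovedʳ g cB b _ = refl
rejoin-unmovedʳ g cO b h = h refl

data Moved : Cls → Set where
  mI : Moved cI
  mI' : Moved cI'
  mA : Moved cA
  mB : Moved cB

moved? : ∀ c → c ≡ cO ⊎ Moved c
moved? cI = inj₂ mI
moved? cI' = inj₂ mI'
moved? cA = inj₂ mA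
moved? cB = inj₂ mB
moved? cO = inj₁ refl

¬Moved-cO : ¬ Moved cO
¬Moved-cO ()

rejoin-moved : ∀ g {c d} b → Moved c → Moved d → rejoin g c d b ≡ (g c ≡ᵇ g d)
rejoin-moved g b mI mI = refl
rejoin-moved g b mI mI' = refl
rejoin-moved g b mI mA = refl
rejoin-moved g b mI mB = refl
rejoin-moved g b mI' mI = refl
rejoin-moved g b mI' mI' = refl
rejoin-moved g b mI' mA = refl
rejoin-moved g b mI' mB = refl
rejoin-moved g b mA mI = refl
rejoin-moved g b mA mI' = refl
rejoin-moved g b mA mA = refl
rejoin-moved g b mA mB = refl
rejoin-moved g b mB mI = refl
rejoin-moved g b mB mI' = refl
rejoin-moved g b mB mA = refl
rejoin-moved g b mB mB = refl

module Noncrossing {n : ℕ} {π : Rel} (ncπ : IsNC n π) where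

  open IsSetPartition (proj₁ ncπ)

  ~sym : ∀ {a b} → InN n a → InN n b → π a b ≡ true → π b a ≡ true
  ~sym {a} {b} = symP a b

  ~trans : ∀ {a b c} → InN n a → InN n b → InN n c → π a b ≡ true → π b c ≡ true → π a c ≡ true
  ~trans {a} {b} {c} = transP a b c

  ~refl : ∀ {a} → InN n a → π a a ≡ true
  ~refl {a} = reflP a

  uncross : ∀ {a b c d} → InN n a → InN n b → InN n c → InN n d → a < b → b < c → c < d →
    π a c ≡ true → π b d ≡ true → π a b ≡ true
  uncross {a} {b} {c} {d} a∈ b∈ c∈ d∈ a<b b<c c<d ac bd =
    proj₁ (proj₂ ncπ a b c d a∈ b∈ c∈ d∈ a<b b<c c<d ac bd)

  ≁-resp-~ : ∀ {a u v} → InN n a → InN n u → InN n v → π v u ≡ true → π v a ≡ false → π u a ≡ false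
  ≁-resp-~ {a} {u} {v} a∈ u∈ v∈ vu va with π u a in ua
  ... | true = ⊥-elim (true≢false (trans (sym (~trans v∈ u∈ a∈ vu ua)) va))
  ... | false = refl

  ≁-sym : ∀ {a b} → InN n a → InN n b → π a b ≡ false → π b a ≡ false
  ≁-sym {a} {b} a∈ b∈ ab with π b a in ba
  ... | false = refl
  ... | true = ⊥-elim (true≢false (trans (sym (~sym b∈ a∈ ba)) ab))

  -- A block not containing a lies entirely inside or entirely outside the arc from a to c.
  inside-arc : ∀ {a c u v} → InN n a → InN n c → InN n u → InN n v → π a c ≡ true →
    π v u ≡ true → π v a ≡ false → a < u → u < c → a < v × v < c
  inside-arc {a} {c} {u} {v} a∈ c∈ u∈ v∈ ac vu va a<u u<c with <-cmp v a | <-cmp v c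
  ... | tri< v<a _ _ | _ = ⊥-elim (true≢false (trans (sym (uncross v∈ a∈ u∈ c∈ v<a a<u u<c vu ac)) va))
  ... | tri≈ _ refl _ | _ = ⊥-elim (true≢false (trans (sym (~refl v∈)) va))
  ... | tri> _ _ a<v | tri< v<c _ _ = a<v , v<c
  ... | tri> _ _ _ | tri≈ _ refl _ = ⊥-elim (true≢false (trans (sym (~sym a∈ c∈ ac)) va))
  ... | tri> _ _ _ | tri> _ _ c<v = ⊥-elim (true≢false (trans (sym (~trans v∈ u∈ a∈ vu ua)) va))
    where
    ua : π u a ≡ true
    ua = ~sym a∈ u∈ (uncross a∈ u∈ c∈ v∈ a<u u<c c<v ac (~sym v∈ u∈ vu))

act-resp-≈ : ∀ {n k R S} → 1 ≤ k → suc k ≤ n → R ≈[ n ] S → act k R ≈[ n ] act k S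
act-resp-≈ 1≤k k<n R≈S x∈ y∈ = R≈S (swp-inN 1≤k k<n x∈) (swp-inN 1≤k k<n y∈)

regroup-resp-≈ : ∀ {n k R S} g → InN n k → InN n (suc k) → R ≈[ n ] S → regroup g k R ≈[ n ] regroup g k S
regroup-resp-≈ {k = k} {R} {S} g k∈ k′∈ R≈S {x} {y} x∈ y∈ =
  begin
    regroup g k R x y                          ≡⟨ regroup≡rejoin g k R x y ⟩
    rejoin g (cls k R x) (cls k R y) (R x y)   ≡⟨ cong₂ (λ c d → rejoin g c d (R x y)) (same-cls x∈) (same-cls y∈) ⟩
    rejoin g (cls k S x) (cls k S y) (R x y)   ≡⟨ cong (rejoin g (cls k S x) (cls k S y)) (R≈S x∈ y∈) ⟩
    rejoin g (cls k S x) (cls k S y) (S x y)   ≡⟨ regroup≡rejoin g k S x y ⟨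
    regroup g k S x y                          ∎
  where
  open ≡-Reasoning
  same-cls : ∀ {z} → InN _ z → cls k R z ≡ cls k S z
  same-cls z∈ rewrite R≈S k∈ z∈ | R≈S k′∈ z∈ = refl

-- Positions of the elements moved by the skein terms at k. In s_k(π) the classes cA and cB of
-- Defs.cls are the blocks of k+1 and of k in π; they are split into the parts left and right of k.
data Zone : Set where
  leftA leftB atK atK′ rightA rightB : Zone

zoneRank : Zone → ℕ
zoneRank leftA = 0
zoneRank leftB = 1
zoneRank atK = 2
zoneRank atK′ = 3
zoneRank rightA = 4
zoneRank rightB = 5

-- Zones may occur in rank order, except that leftA … rightB would make the blocks of k and k+1 cross.
_⊑_ : Zone → Zone → Bool
leftA ⊑ rightB = false
z ⊑ z′ = zoneRank z ≤ᵇ zoneRank z′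

zoneCls : Zone → Cls
zoneCls leftA = cA
zoneCls rightA = cA
zoneCls leftB = cB
zoneCls rightB = cB
zoneCls atK = cI
zoneCls atK′ = cI'

sameLabel : (Cls → ℕ) → Zone → Zone → Bool
sameLabel g z z′ = g (zoneCls z) ≡ᵇ g (zoneCls z′)

zoneQuadOK : (Cls → ℕ) → Zone → Zone → Zone → Zone → Bool
zoneQuadOK g z₁ z₂ z₃ z₄ =
  not (z₁ ⊑ z₂ ∧ z₂ ⊑ z₃ ∧ z₃ ⊑ z₄ ∧ z₁ ⊑ z₄ ∧ sameLabel g z₁ z₃ ∧ sameLabel g z₂ z₄)
  ∨ (sameLabel g z₁ z₂ ∧ sameLabel g z₁ z₄ ∧ sameLabel g z₃ z₂)

allZones : (Zone → Bool) → Bool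
allZones p = p leftA ∧ p leftB ∧ p atK ∧ p atK′ ∧ p rightA ∧ p rightB

allZones-sound : ∀ p → allZones p ≡ true → ∀ z → p z ≡ true
allZones-sound p e leftA = ∧-true⇒ˡ e
allZones-sound p e leftB = ∧-true⇒ˡ (∧-true⇒ʳ {p leftA} e)
allZones-sound p e atK = ∧-true⇒ˡ (∧-true⇒ʳ {p leftB} (∧-true⇒ʳ {p leftA} e))
allZones-sound p e atK′ = ∧-true⇒ˡ (∧-true⇒ʳ {p atK} (∧-true⇒ʳ {p leftB} (∧-true⇒ʳ {p leftA} e)))
allZones-sound p e rightA =
  ∧-true⇒ˡ (∧-true⇒ʳ {p atK′} (∧-true⇒ʳ {p atK} (∧-true⇒ʳ {p leftB} (∧-true⇒ʳ {p leftA} e))))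
allZones-sound p e rightB =
  ∧-true⇒ʳ {p rightA} (∧-true⇒ʳ {p atK′} (∧-true⇒ʳ {p atK} (∧-true⇒ʳ {p leftB} (∧-true⇒ʳ {p leftA} e))))

sameLabel-sym : ∀ g z z′ → sameLabel g z z′ ≡ true → sameLabel g z′ z ≡ true
sameLabel-sym g z z′ e rewrite ≡ᵇ-true⇒≡ {g (zoneCls z)} e = ≡ᵇ-refl (g (zoneCls z′))

sameLabel-trans : ∀ g z z′ z″ → sameLabel g z z′ ≡ true → sameLabel g z′ z″ ≡ true → sameLabel g z z″ ≡ true
sameLabel-trans g z z′ z″ e e′ rewrite ≡ᵇ-true⇒≡ {g (zoneCls z)} e = e′

NoncrossingLabelling : (Cls → ℕ) → Set
NoncrossingLabelling g = ∀ z₁ z₂ z₃ z₄ →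
  (z₁ ⊑ z₂) ≡ true → (z₂ ⊑ z₃) ≡ true → (z₃ ⊑ z₄) ≡ true → (z₁ ⊑ z₄) ≡ true →
  sameLabel g z₁ z₃ ≡ true → sameLabel g z₂ z₄ ≡ true →
  sameLabel g z₁ z₂ ≡ true × sameLabel g z₁ z₄ ≡ true × sameLabel g z₃ z₂ ≡ true

zoneQuadOK-sound : ∀ g {z₁ z₂ z₃ z₄} → zoneQuadOK g z₁ z₂ z₃ z₄ ≡ true →
  (z₁ ⊑ z₂) ≡ true → (z₂ ⊑ z₃) ≡ true → (z₃ ⊑ z₄) ≡ true → (z₁ ⊑ z₄) ≡ true →
  sameLabel g z₁ z₃ ≡ true → sameLabel g z₂ z₄ ≡ true →
  sameLabel g z₁ z₂ ≡ true × sameLabel g z₁ z₄ ≡ true × sameLabel g z₃ z₂ ≡ true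
zoneQuadOK-sound g {z₁} {z₂} {z₃} {z₄} ok e₁ e₂ e₃ e₄ e₅ e₆ rewrite e₁ | e₂ | e₃ | e₄ | e₅ | e₆ =
  ∧-true⇒ˡ ok , ∧-true⇒ˡ (∧-true⇒ʳ {sameLabel g z₁ z₂} ok) ,
  ∧-true⇒ʳ {sameLabel g z₁ z₄} (∧-true⇒ʳ {sameLabel g z₁ z₂} ok)

noncrossingLabelling : ∀ g →
  allZones (λ z₁ → allZones λ z₂ → allZones λ z₃ → allZones λ z₄ → zoneQuadOK g z₁ z₂ z₃ z₄) ≡ true →
  NoncrossingLabelling g
noncrossingLabelling g e z₁ z₂ z₃ z₄ = zoneQuadOK-sound g
  (allZones-sound (zoneQuadOK g z₁ z₂ z₃) (allZones-sound (λ z₃ → allZones (zoneQuadOK g z₁ z₂ z₃))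
    (allZones-sound (λ z₂ → allZones λ z₃ → allZones (zoneQuadOK g z₁ z₂ z₃))
      (allZones-sound (λ z₁ → allZones λ z₂ → allZones λ z₃ → allZones (zoneQuadOK g z₁ z₂ z₃)) e z₁) z₂) z₃) z₄)

g₂-noncrossing : NoncrossingLabelling g₂
g₂-noncrossing = noncrossingLabelling g₂ refl

g₃-noncrossing : NoncrossingLabelling g₃
g₃-noncrossing = noncrossingLabelling g₃ refl

g₄-noncrossing : NoncrossingLabelling g₄
g₄-noncrossing = noncrossingLabelling g₄ refl

module Transposition {n k : ℕ} (1≤k : 1 ≤ k) (k<n : suc k ≤ n) {π : Rel} (ncπ : IsNC n π) where

  open Noncrossing ncπ

  k∈ : InN n k
  k∈ = 1≤k , ≤-trans (n≤1+n k) k<n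

  k′∈ : InN n (suc k)
  k′∈ = s≤s z≤n , k<n

  ρ : Rel
  ρ = act k π

  swp∈ : ∀ {x} → InN n x → InN n (swp k x)
  swp∈ = swp-inN 1≤k k<n

  act-isSetPartition : IsSetPartition n ρ
  act-isSetPartition = record
    { reflP = λ a a∈ → ~refl (swp∈ a∈)
    ; symP = λ a b a∈ b∈ → ~sym (swp∈ a∈) (swp∈ b∈)
    ; transP = λ a b c a∈ b∈ c∈ → ~trans (swp∈ a∈) (swp∈ b∈) (swp∈ c∈) }

  ≈-act-act : π ≈[ n ] act k ρ
  ≈-act-act {x} {y} _ _ = sym (cong₂ π (swp-involutive k x) (swp-involutive k y))

  data Class (x : ℕ) : Set where
    isK : x ≡ k → cls k ρ x ≡ cI → Class x
    isK′ : x ≡ suc k → cls k ρ x ≡ cI' → Class x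
    inA : x ≢ k → x ≢ suc k → π (suc k) x ≡ true → cls k ρ x ≡ cA → Class x
    inB : x ≢ k → x ≢ suc k → π (suc k) x ≡ false → π k x ≡ true → cls k ρ x ≡ cB → Class x
    unmoved : x ≢ k → x ≢ suc k → π (suc k) x ≡ false → π k x ≡ false → cls k ρ x ≡ cO → Class x

  outerCls : Bool → Bool → Cls
  outerCls a b = if a then cA else if b then cB else cO

  cls-other : ∀ {x} → x ≢ k → x ≢ suc k → cls k ρ x ≡ outerCls (π (suc k) x) (π k x)
  cls-other x≢k x≢k′
    rewrite ≢⇒≡ᵇ-false x≢k | ≢⇒≡ᵇ-false x≢k′ | swp-left k | swp-right k = refl

  cls-k : cls k ρ k ≡ cI
  cls-k rewrite ≡ᵇ-refl k = refl

  cls-k′ : cls k ρ (suc k) ≡ cI'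
  cls-k′ rewrite ≢⇒≡ᵇ-false (suc≢ k) | ≡ᵇ-refl k = refl

  classOf : ∀ x → Class x
  classOf x with x ≟ k | x ≟ suc k
  ... | yes refl | _ = isK refl cls-k
  ... | no _ | yes refl = isK′ refl cls-k′
  ... | no x≢k | no x≢k′ with π (suc k) x in A | π k x in B
  ... | true | _ = inA x≢k x≢k′ A (trans (cls-other x≢k x≢k′) (cong₂ outerCls A B))
  ... | false | true = inB x≢k x≢k′ A B (trans (cls-other x≢k x≢k′) (cong₂ outerCls A B))
  ... | false | false = unmoved x≢k x≢k′ A B (trans (cls-other x≢k x≢k′) (cong₂ outerCls A B))

  moved⇒anchored : ∀ {u} → InN n u → Moved (cls k ρ u) → π k u ≡ true ⊎ π (suc k) u ≡ true
  moved⇒anchored {u} u∈ m with classOf u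
  ... | isK refl _ = inj₁ (~refl k∈)
  ... | isK′ refl _ = inj₂ (~refl k′∈)
  ... | inA _ _ A _ = inj₂ A
  ... | inB _ _ _ B _ = inj₁ B
  ... | unmoved _ _ _ _ c = ⊥-elim (¬Moved-cO (subst Moved c m))

  beyond : ∀ {x} → x ≢ k → x ≢ suc k → (x <ᵇ k) ≡ false → suc k < x
  beyond x≢k x≢k′ x≮k = ≤∧≢⇒< (≤∧≢⇒< (<ᵇ-false⇒≥ x≮k) (x≢k ∘ sym)) (x≢k′ ∘ sym)

  singleton-unlinked : ∀ {p a c} → (∀ {y} → InN n y → ρ p y ≡ true → y ≡ p) →
    InN n a → InN n c → a < c → ρ a c ≡ true → a ≢ p × c ≢ p
  singleton-unlinked {p} {a} {c} alone a∈ c∈ a<c ac =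
    (λ { refl → <-irrefl (sym (alone c∈ ac)) a<c }) ,
    (λ { refl → <-irrefl (alone a∈ (IsSetPartition.symP act-isSetPartition a c a∈ c∈ ac)) a<c })

  act-isNoncrossing-if-k-alone : (∀ {x} → InN n x → x ≢ k → π k x ≡ false) → IsNoncrossing n ρ
  act-isNoncrossing-if-k-alone alone a b c d a∈ b∈ c∈ d∈ a<b b<c c<d ac bd =
    proj₂ ncπ (swp k a) (swp k b) (swp k c) (swp k d) (swp∈ a∈) (swp∈ b∈) (swp∈ c∈) (swp∈ d∈)
      (swp-monoˡ k a≢ b≢ a<b) (swp-monoˡ k b≢ c≢ b<c) (swp-monoˡ k c≢ d≢ c<d) ac bd
    where
    k′-alone : ∀ {y} → InN n y → ρ (suc k) y ≡ true → y ≡ suc k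
    k′-alone {y} y∈ e with swp k y ≟ k
    ... | yes swp≡k = swp≡left⇒ k swp≡k
    ... | no swp≢k = ⊥-elim (true≢false (trans (sym e) (trans (cong (λ z → π z (swp k y)) (swp-right k))
                                                               (alone (swp∈ y∈) swp≢k))))
    a≢ : a ≢ suc k
    a≢ = proj₁ (singleton-unlinked k′-alone a∈ c∈ (<-trans a<b b<c) ac)
    c≢ : c ≢ suc k
    c≢ = proj₂ (singleton-unlinked k′-alone a∈ c∈ (<-trans a<b b<c) ac)
    b≢ : b ≢ suc k
    b≢ = proj₁ (singleton-unlinked k′-alone b∈ d∈ (<-trans b<c c<d) bd)
    d≢ : d ≢ suc k
    d≢ = proj₂ (singleton-unlinked k′-alone b∈ d∈ (<-trans b<c c<d) bd)

  act-isNoncrossing-if-k′-alone : (∀ {x} → InN n x → x ≢ suc k → π (suc k) x ≡ false) → IsNoncrossing n ρ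
  act-isNoncrossing-if-k′-alone alone a b c d a∈ b∈ c∈ d∈ a<b b<c c<d ac bd =
    proj₂ ncπ (swp k a) (swp k b) (swp k c) (swp k d) (swp∈ a∈) (swp∈ b∈) (swp∈ c∈) (swp∈ d∈)
      (swp-monoʳ k a≢ b≢ a<b) (swp-monoʳ k b≢ c≢ b<c) (swp-monoʳ k c≢ d≢ c<d) ac bd
    where
    k-alone : ∀ {y} → InN n y → ρ k y ≡ true → y ≡ k
    k-alone {y} y∈ e with swp k y ≟ suc k
    ... | yes swp≡k′ = swp≡right⇒ k swp≡k′
    ... | no swp≢k′ = ⊥-elim (true≢false (trans (sym e) (trans (cong (λ z → π z (swp k y)) (swp-left k))
                                                                 (alone (swp∈ y∈) swp≢k′))))
    a≢ : a ≢ k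
    a≢ = proj₁ (singleton-unlinked k-alone a∈ c∈ (<-trans a<b b<c) ac)
    c≢ : c ≢ k
    c≢ = proj₂ (singleton-unlinked k-alone a∈ c∈ (<-trans a<b b<c) ac)
    b≢ : b ≢ k
    b≢ = proj₁ (singleton-unlinked k-alone b∈ d∈ (<-trans b<c c<d) bd)
    d≢ : d ≢ k
    d≢ = proj₂ (singleton-unlinked k-alone b∈ d∈ (<-trans b<c c<d) bd)

  module Separated (k≁k′ : π k (suc k) ≡ false) where

    zoneOf : Cls → Bool → Zone
    zoneOf cA true = leftA
    zoneOf cA false = rightA
    zoneOf cB true = leftB
    zoneOf cB false = rightB
    zoneOf cI _ = atK
    zoneOf cI' _ = atK′
    zoneOf cO _ = atK

    zone : ℕ → Zone
    zone x = zoneOf (cls k ρ x) (x <ᵇ k)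

    ZoneFacts : Zone → ℕ → Set
    ZoneFacts leftA x = π (suc k) x ≡ true × x < k
    ZoneFacts leftB x = π k x ≡ true × x < k
    ZoneFacts atK x = x ≡ k
    ZoneFacts atK′ x = x ≡ suc k
    ZoneFacts rightA x = π (suc k) x ≡ true × suc k < x
    ZoneFacts rightB x = π k x ≡ true × suc k < x

    factsA : ∀ {x} → x ≢ k → x ≢ suc k → π (suc k) x ≡ true →
      ∀ b → (x <ᵇ k) ≡ b → ZoneFacts (zoneOf cA b) x
    factsA _ _ A true x<k = A , <ᵇ-true⇒< x<k
    factsA x≢k x≢k′ A false x≮k = A , beyond x≢k x≢k′ x≮k

    factsB : ∀ {x} → x ≢ k → x ≢ suc k → π k x ≡ true →
      ∀ b → (x <ᵇ k) ≡ b → ZoneFacts (zoneOf cB b) x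
    factsB _ _ B true x<k = B , <ᵇ-true⇒< x<k
    factsB x≢k x≢k′ B false x≮k = B , beyond x≢k x≢k′ x≮k

    via-cls : ∀ {x c} → cls k ρ x ≡ c → ZoneFacts (zoneOf c (x <ᵇ k)) x → ZoneFacts (zone x) x
    via-cls refl f = f

    zone-facts : ∀ x → Moved (cls k ρ x) → ZoneFacts (zone x) x
    zone-facts x m with classOf x
    ... | isK x≡k c = via-cls c x≡k
    ... | isK′ x≡k′ c = via-cls c x≡k′
    ... | inA x≢k x≢k′ A c = via-cls c (factsA x≢k x≢k′ A _ refl)
    ... | inB x≢k x≢k′ _ B c = via-cls c (factsB x≢k x≢k′ B _ refl)
    ... | unmoved _ _ _ _ c = ⊥-elim (¬Moved-cO (subst Moved c m))

    zoneCls-zoneOf : ∀ {c} b → Moved c → zoneCls (zoneOf c b) ≡ c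
    zoneCls-zoneOf _ mI = refl
    zoneCls-zoneOf _ mI' = refl
    zoneCls-zoneOf true mA = refl
    zoneCls-zoneOf false mA = refl
    zoneCls-zoneOf true mB = refl
    zoneCls-zoneOf false mB = refl

    A∩B-empty : ∀ {x} → InN n x → π k x ≡ true → π (suc k) x ≡ true → ⊥
    A∩B-empty x∈ kx k′x = true≢false (trans (sym (~trans k∈ x∈ k′∈ kx (~sym k′∈ x∈ k′x))) k≁k′)

    leftB<leftA-impossible : ∀ {x y} → InN n x → InN n y → x < y → y < k →
      π k x ≡ true → π (suc k) y ≡ true → ⊥
    leftB<leftA-impossible x∈ y∈ x<y y<k kx k′y =
      A∩B-empty y∈ (~trans k∈ x∈ y∈ kx (uncross x∈ y∈ k∈ k′∈ x<y y<k (n<1+n k) (~sym k∈ x∈ kx) (~sym k′∈ y∈ k′y))) k′y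

    rightB<rightA-impossible : ∀ {x y} → InN n x → InN n y → suc k < x → x < y →
      π k x ≡ true → π (suc k) y ≡ true → ⊥
    rightB<rightA-impossible x∈ y∈ k′<x x<y kx k′y =
      true≢false (trans (sym (uncross k∈ k′∈ x∈ y∈ (n<1+n k) k′<x x<y kx k′y)) k≁k′)

    leftA-rightB-impossible : ∀ {x y} → InN n x → InN n y → x < k → suc k < y →
      π (suc k) x ≡ true → π k y ≡ true → ⊥
    leftA-rightB-impossible x∈ y∈ x<k k′<y k′x ky =
      A∩B-empty x∈ (~sym x∈ k∈ (uncross x∈ k∈ k′∈ y∈ x<k (n<1+n k) k′<y (~sym k′∈ x∈ k′x) ky)) k′x

    zone-mono : ∀ {x y} → InN n x → InN n y → Moved (cls k ρ x) → Moved (cls k ρ y) → x < y →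
      (zone x ⊑ zone y) ≡ true
    zone-mono {x} {y} x∈ y∈ mx my x<y with zone x | zone y | zone-facts x mx | zone-facts y my
    ... | leftA | leftA | _ | _ = refl
    ... | leftA | leftB | _ | _ = refl
    ... | leftA | atK | _ | _ = refl
    ... | leftA | atK′ | _ | _ = refl
    ... | leftA | rightA | _ | _ = refl
    ... | leftA | rightB | (p₁ , l₁) | (p₂ , l₂) = ⊥-elim (leftA-rightB-impossible x∈ y∈ l₁ l₂ p₁ p₂)
    ... | leftB | leftA | (p₁ , _) | (p₂ , l₂) = ⊥-elim (leftB<leftA-impossible x∈ y∈ x<y l₂ p₁ p₂)
    ... | leftB | leftB | _ | _ = refl
    ... | leftB | atK | _ | _ = refl
    ... | leftB | atK′ | _ | _ = refl
    ... | leftB | rightA | _ | _ = refl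
    ... | leftB | rightB | _ | _ = refl
    ... | atK | leftA | f₁ | (_ , l₂) = ⊥-elim (<-asym (subst (_< y) f₁ x<y) l₂)
    ... | atK | leftB | f₁ | (_ , l₂) = ⊥-elim (<-asym (subst (_< y) f₁ x<y) l₂)
    ... | atK | atK | _ | _ = refl
    ... | atK | atK′ | _ | _ = refl
    ... | atK | rightA | _ | _ = refl
    ... | atK | rightB | _ | _ = refl
    ... | atK′ | leftA | f₁ | (_ , l₂) = ⊥-elim (<-asym (<-trans (n<1+n k) (subst (_< y) f₁ x<y)) l₂)
    ... | atK′ | leftB | f₁ | (_ , l₂) = ⊥-elim (<-asym (<-trans (n<1+n k) (subst (_< y) f₁ x<y)) l₂)
    ... | atK′ | atK | f₁ | f₂ = ⊥-elim (<-asym (n<1+n k) (subst₂ _<_ f₁ f₂ x<y))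
    ... | atK′ | atK′ | _ | _ = refl
    ... | atK′ | rightA | _ | _ = refl
    ... | atK′ | rightB | _ | _ = refl
    ... | rightA | leftA | (_ , l₁) | (_ , l₂) = ⊥-elim (<-asym (<-trans (<-trans (n<1+n k) l₁) x<y) l₂)
    ... | rightA | leftB | (_ , l₁) | (_ , l₂) = ⊥-elim (<-asym (<-trans (<-trans (n<1+n k) l₁) x<y) l₂)
    ... | rightA | atK | (_ , l₁) | f₂ = ⊥-elim (<-asym (<-trans (n<1+n k) l₁) (subst (x <_) f₂ x<y))
    ... | rightA | atK′ | (_ , l₁) | f₂ = ⊥-elim (<-asym l₁ (subst (x <_) f₂ x<y))
    ... | rightA | rightA | _ | _ = refl
    ... | rightA | rightB | _ | _ = refl
    ... | rightB | leftA | (_ , l₁) | (_ , l₂) = ⊥-elim (<-asym (<-trans (<-trans (n<1+n k) l₁) x<y) l₂)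
    ... | rightB | leftB | (_ , l₁) | (_ , l₂) = ⊥-elim (<-asym (<-trans (<-trans (n<1+n k) l₁) x<y) l₂)
    ... | rightB | atK | (_ , l₁) | f₂ = ⊥-elim (<-asym (<-trans (n<1+n k) l₁) (subst (x <_) f₂ x<y))
    ... | rightB | atK′ | (_ , l₁) | f₂ = ⊥-elim (<-asym l₁ (subst (x <_) f₂ x<y))
    ... | rightB | rightA | (p₁ , l₁) | (p₂ , _) = ⊥-elim (rightB<rightA-impossible x∈ y∈ l₁ x<y p₁ p₂)
    ... | rightB | rightB | _ | _ = refl

    unmoved⇒ : ∀ x → cls k ρ x ≡ cO → x ≢ k × x ≢ suc k × π (suc k) x ≡ false × π k x ≡ false
    unmoved⇒ x o with classOf x
    ... | isK _ c = ⊥-elim (¬Moved-cO (subst Moved (trans (sym c) o) mI))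
    ... | isK′ _ c = ⊥-elim (¬Moved-cO (subst Moved (trans (sym c) o) mI'))
    ... | inA _ _ _ c = ⊥-elim (¬Moved-cO (subst Moved (trans (sym c) o) mA))
    ... | inB _ _ _ _ c = ⊥-elim (¬Moved-cO (subst Moved (trans (sym c) o) mB))
    ... | unmoved x≢k x≢k′ A B _ = x≢k , x≢k′ , A , B

    module _ {a c} (a∈ : InN n a) (c∈ : InN n c) (ac : π a c ≡ true)
             (oa : cls k ρ a ≡ cO) (oc : cls k ρ c ≡ cO) where

      private
        a≢k : a ≢ k
        a≢k = proj₁ (unmoved⇒ a oa)
        k′≁a : π (suc k) a ≡ false
        k′≁a = proj₁ (proj₂ (proj₂ (unmoved⇒ a oa)))
        k≁a : π k a ≡ false
        k≁a = proj₂ (proj₂ (proj₂ (unmoved⇒ a oa)))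
        c≢k′ : c ≢ suc k
        c≢k′ = proj₁ (proj₂ (unmoved⇒ c oc))

      moved-in-arc⇒k-in-arc : ∀ {u} → InN n u → Moved (cls k ρ u) → a < u → u < c → a < k × k < c
      moved-in-arc⇒k-in-arc u∈ mu a<u u<c with moved⇒anchored u∈ mu
      ... | inj₁ ku = inside-arc a∈ c∈ u∈ k∈ ac ku k≁a a<u u<c
      ... | inj₂ k′u with inside-arc a∈ c∈ u∈ k′∈ ac k′u k′≁a a<u u<c
      ...   | a<k′ , k′<c = ≤∧≢⇒< (≤-pred a<k′) a≢k , <-trans (n<1+n k) k′<c

      k-in-arc⇒moved-in-arc : ∀ {u} → InN n u → Moved (cls k ρ u) → a < k → k < c → a < u × u < c
      k-in-arc⇒moved-in-arc u∈ mu a<k k<c with moved⇒anchored u∈ mu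
      ... | inj₁ ku = inside-arc a∈ c∈ k∈ u∈ ac (~sym k∈ u∈ ku) (≁-resp-~ a∈ u∈ k∈ ku k≁a) a<k k<c
      ... | inj₂ k′u = inside-arc a∈ c∈ k′∈ u∈ ac (~sym k′∈ u∈ k′u) (≁-resp-~ a∈ u∈ k′∈ k′u k′≁a)
                         (<-trans a<k (n<1+n k)) (≤∧≢⇒< k<c (c≢k′ ∘ sym))

      moved-same-side : ∀ {u v} → InN n u → InN n v → Moved (cls k ρ u) → Moved (cls k ρ v) →
        a < u → u < c → a < v × v < c
      moved-same-side u∈ v∈ mu mv a<u u<c =
        let a<k , k<c = moved-in-arc⇒k-in-arc u∈ mu a<u u<c in k-in-arc⇒moved-in-arc v∈ mv a<k k<c

    act-crossing : ∀ {a b} → InN n a → InN n b → a ≢ k → π k a ≡ true → b ≢ suc k → π (suc k) b ≡ true →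
      ncᵇ n ρ ≡ false
    act-crossing {a} {b} a∈ b∈ a≢k ka b≢k′ k′b = by-position (<-cmp a k) (<-cmp b k)
      where
      a≢k′ : a ≢ suc k
      a≢k′ refl = true≢false (trans (sym ka) k≁k′)
      b≢k : b ≢ k
      b≢k refl = true≢false (trans (sym (~sym k′∈ k∈ k′b)) k≁k′)
      a≁k′ : π a (suc k) ≡ false
      a≁k′ = ≁-resp-~ k′∈ a∈ k∈ ka k≁k′
      b≁a : π b a ≡ false
      b≁a = ≁-sym a∈ b∈ (≁-resp-~ b∈ a∈ k∈ ka (≁-sym b∈ k∈ (≁-resp-~ k∈ b∈ k′∈ k′b (≁-sym k∈ k′∈ k≁k′))))
      ρ≡π : ∀ x y {x′ y′} → swp k x ≡ x′ → swp k y ≡ y′ → ρ x y ≡ π x′ y′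
      ρ≡π _ _ = cong₂ π
      sa : swp k a ≡ a
      sa = swp-other k a≢k a≢k′
      sb : swp k b ≡ b
      sb = swp-other k b≢k b≢k′
      beyond′ : ∀ {x} → x ≢ suc k → k < x → suc k < x
      beyond′ x≢k′ k<x = ≤∧≢⇒< k<x (x≢k′ ∘ sym)
      by-position : Tri (a < k) (a ≡ k) (k < a) → Tri (b < k) (b ≡ k) (k < b) → ncᵇ n ρ ≡ false
      by-position (tri≈ _ a≡k _) _ = ⊥-elim (a≢k a≡k)
      by-position _ (tri≈ _ b≡k _) = ⊥-elim (b≢k b≡k)
      by-position (tri> _ _ k<a) (tri< b<k _ _) =
        ⊥-elim (leftA-rightB-impossible b∈ a∈ b<k (beyond′ a≢k′ k<a) k′b ka)
      by-position (tri< a<k _ _) (tri> _ _ k<b) =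
        crossing⇒ncᵇ-false n ρ a∈ k∈ k′∈ b∈ a<k (n<1+n k) (beyond′ b≢k′ k<b)
          (trans (ρ≡π a (suc k) sa (swp-right k)) (~sym k∈ a∈ ka)) (trans (ρ≡π k b (swp-left k) sb) k′b)
          (trans (ρ≡π a k sa (swp-left k)) a≁k′)
      by-position (tri< a<k _ _) (tri< b<k _ _) with <-cmp a b
      ... | tri< a<b _ _ = ⊥-elim (leftB<leftA-impossible a∈ b∈ a<b b<k ka k′b)
      ... | tri≈ _ refl _ = ⊥-elim (A∩B-empty a∈ ka k′b)
      ... | tri> _ _ b<a =
        crossing⇒ncᵇ-false n ρ b∈ a∈ k∈ k′∈ b<a a<k (n<1+n k)
          (trans (ρ≡π b k sb (swp-left k)) (~sym k′∈ b∈ k′b)) (trans (ρ≡π a (suc k) sa (swp-right k)) (~sym k∈ a∈ ka))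
          (trans (ρ≡π b a sb sa) b≁a)
      by-position (tri> _ _ k<a) (tri> _ _ k<b) with <-cmp a b
      ... | tri< a<b _ _ = ⊥-elim (rightB<rightA-impossible a∈ b∈ (beyond′ a≢k′ k<a) a<b ka k′b)
      ... | tri≈ _ refl _ = ⊥-elim (A∩B-empty a∈ ka k′b)
      ... | tri> _ _ b<a =
        crossing⇒ncᵇ-false n ρ k∈ k′∈ b∈ a∈ (n<1+n k) (beyond′ b≢k′ k<b) b<a
          (trans (ρ≡π k b (swp-left k) sb) k′b) (trans (ρ≡π (suc k) a (swp-right k) sa) ka)
          (trans (ρ≡π k (suc k) (swp-left k) (swp-right k)) (≁-sym k∈ k′∈ k≁k′))

    act-ncᵇ : ncᵇ n ρ ≡ not ((1 ≤ᵇ companions n π k) ∧ (1 ≤ᵇ companions n π (suc k)))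
    act-ncᵇ with 1 ≤ᵇ companions n π k in k-linked | 1 ≤ᵇ companions n π (suc k) in k′-linked
    ... | false | _ = ncᵇ-complete n ρ (act-isNoncrossing-if-k-alone (no-companion n π k k-linked))
    ... | true | false = ncᵇ-complete n ρ (act-isNoncrossing-if-k′-alone (no-companion n π (suc k) k′-linked))
    ... | true | true with some-companion n π k k-linked | some-companion n π (suc k) k′-linked
    ...   | a , a∈ , a≢k , ka | b , b∈ , b≢k′ , k′b = act-crossing a∈ b∈ a≢k ka b≢k′ k′b

    module Regrouped (g : Cls → ℕ) (noncrossing-g : NoncrossingLabelling g) where

      R : Rel
      R = regroup g k ρ

      R-unmoved : ∀ x y → cls k ρ x ≡ cO → cls k ρ y ≡ cO → R x y ≡ π x y
      R-unmoved x y ox oy with unmoved⇒ x ox | unmoved⇒ y oy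
      ... | x≢k , x≢k′ , _ | y≢k , y≢k′ , _ =
        begin
          R x y                                     ≡⟨ regroup≡rejoin g k ρ x y ⟩
          rejoin g (cls k ρ x) (cls k ρ y) (ρ x y)  ≡⟨ cong₂ (λ c d → rejoin g c d (ρ x y)) ox oy ⟩
          ρ x y                                     ≡⟨ cong₂ π (swp-other k x≢k x≢k′) (swp-other k y≢k y≢k′) ⟩
          π x y                                     ∎
        where open ≡-Reasoning

      unmovedArc : ∀ x y → cls k ρ x ≡ cO → cls k ρ y ≡ cO → R x y ≡ true → π x y ≡ true
      unmovedArc x y ox oy Rxy = trans (sym (R-unmoved x y ox oy)) Rxy

      R-mixed : ∀ x y → cls k ρ x ≡ cO → Moved (cls k ρ y) → R x y ≡ false
      R-mixed x y ox my = trans (regroup≡rejoin g k ρ x y)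
        (trans (cong (λ c → rejoin g c (cls k ρ y) (ρ x y)) ox)
               (rejoin-unmovedˡ g (cls k ρ y) (ρ x y) λ oy → ⊥-elim (¬Moved-cO (subst Moved oy my))))

      R-mixed′ : ∀ x y → Moved (cls k ρ x) → cls k ρ y ≡ cO → R x y ≡ false
      R-mixed′ x y mx oy = trans (regroup≡rejoin g k ρ x y)
        (trans (cong (λ c → rejoin g (cls k ρ x) c (ρ x y)) oy)
               (rejoin-unmovedʳ g (cls k ρ x) (ρ x y) λ ox → ⊥-elim (¬Moved-cO (subst Moved ox mx))))

      R-moved : ∀ x y → Moved (cls k ρ x) → Moved (cls k ρ y) → R x y ≡ sameLabel g (zone x) (zone y)
      R-moved x y mx my = trans (regroup≡rejoin g k ρ x y)
        (trans (rejoin-moved g (ρ x y) mx my)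
               (sym (cong₂ (λ c d → g c ≡ᵇ g d) (zoneCls-zoneOf (x <ᵇ k) mx) (zoneCls-zoneOf (y <ᵇ k) my))))

      R-isNoncrossing : IsNoncrossing n R
      R-isNoncrossing a b c d a∈ b∈ c∈ d∈ a<b b<c c<d Rac Rbd
        with moved? (cls k ρ a) | moved? (cls k ρ b) | moved? (cls k ρ c) | moved? (cls k ρ d)
      ... | inj₁ oa | inj₁ ob | inj₁ oc | inj₁ od
        with proj₂ ncπ a b c d a∈ b∈ c∈ d∈ a<b b<c c<d (unmovedArc a c oa oc Rac) (unmovedArc b d ob od Rbd)
      ...   | ab , ad , cb = trans (R-unmoved a b oa ob) ab , trans (R-unmoved a d oa od) ad , trans (R-unmoved c b oc ob) cb
      R-isNoncrossing a b c d a∈ b∈ c∈ d∈ a<b b<c c<d Rac Rbd | inj₁ oa | inj₂ mb | inj₁ oc | inj₂ md =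
        ⊥-elim (<-asym c<d (proj₂ (moved-same-side a∈ c∈ (unmovedArc a c oa oc Rac) oa oc b∈ d∈ mb md a<b b<c)))
      R-isNoncrossing a b c d a∈ b∈ c∈ d∈ a<b b<c c<d Rac Rbd | inj₂ ma | inj₁ ob | inj₂ mc | inj₁ od =
        ⊥-elim (<-asym a<b (proj₁ (moved-same-side b∈ d∈ (unmovedArc b d ob od Rbd) ob od c∈ a∈ mc ma b<c c<d)))
      R-isNoncrossing a b c d a∈ b∈ c∈ d∈ a<b b<c c<d Rac Rbd | inj₂ ma | inj₂ mb | inj₂ mc | inj₂ md
        with noncrossing-g (zone a) (zone b) (zone c) (zone d)
               (zone-mono a∈ b∈ ma mb a<b) (zone-mono b∈ c∈ mb mc b<c) (zone-mono c∈ d∈ mc md c<d)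
               (zone-mono a∈ d∈ ma md (<-trans (<-trans a<b b<c) c<d))
               (trans (sym (R-moved a c ma mc)) Rac) (trans (sym (R-moved b d mb md)) Rbd)
      ...   | ab , ad , cb = trans (R-moved a b ma mb) ab , trans (R-moved a d ma md) ad , trans (R-moved c b mc mb) cb
      R-isNoncrossing a b c d a∈ b∈ c∈ d∈ a<b b<c c<d Rac Rbd | inj₁ oa | _ | inj₂ mc | _ =
        ⊥-elim (true≢false (trans (sym Rac) (R-mixed a c oa mc)))
      R-isNoncrossing a b c d a∈ b∈ c∈ d∈ a<b b<c c<d Rac Rbd | inj₂ ma | _ | inj₁ oc | _ =
        ⊥-elim (true≢false (trans (sym Rac) (R-mixed′ a c ma oc)))
      R-isNoncrossing a b c d a∈ b∈ c∈ d∈ a<b b<c c<d Rac Rbd | _ | inj₁ ob | _ | inj₂ md =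
        ⊥-elim (true≢false (trans (sym Rbd) (R-mixed b d ob md)))
      R-isNoncrossing a b c d a∈ b∈ c∈ d∈ a<b b<c c<d Rac Rbd | _ | inj₂ mb | _ | inj₁ od =
        ⊥-elim (true≢false (trans (sym Rbd) (R-mixed′ b d mb od)))

      R-isSetPartition : IsSetPartition n R
      R-isSetPartition = record { reflP = R-refl ; symP = R-sym ; transP = R-trans }
        where
        R-refl : ∀ a → InN n a → R a a ≡ true
        R-refl a a∈ with moved? (cls k ρ a)
        ... | inj₁ oa = trans (R-unmoved a a oa oa) (~refl a∈)
        ... | inj₂ ma = trans (R-moved a a ma ma) (≡ᵇ-refl (g (zoneCls (zone a))))

        R-sym : ∀ a b → InN n a → InN n b → R a b ≡ true → R b a ≡ true
        R-sym a b a∈ b∈ Rab with moved? (cls k ρ a) | moved? (cls k ρ b)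
        ... | inj₁ oa | inj₁ ob = trans (R-unmoved b a ob oa) (~sym a∈ b∈ (unmovedArc a b oa ob Rab))
        ... | inj₂ ma | inj₂ mb =
          trans (R-moved b a mb ma) (sameLabel-sym g (zone a) (zone b) (trans (sym (R-moved a b ma mb)) Rab))
        ... | inj₁ oa | inj₂ mb = ⊥-elim (true≢false (trans (sym Rab) (R-mixed a b oa mb)))
        ... | inj₂ ma | inj₁ ob = ⊥-elim (true≢false (trans (sym Rab) (R-mixed′ a b ma ob)))

        R-trans : ∀ a b c → InN n a → InN n b → InN n c → R a b ≡ true → R b c ≡ true → R a c ≡ true
        R-trans a b c a∈ b∈ c∈ Rab Rbc with moved? (cls k ρ a) | moved? (cls k ρ b) | moved? (cls k ρ c)
        ... | inj₁ oa | inj₁ ob | inj₁ oc =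
          trans (R-unmoved a c oa oc) (~trans a∈ b∈ c∈ (unmovedArc a b oa ob Rab) (unmovedArc b c ob oc Rbc))
        ... | inj₂ ma | inj₂ mb | inj₂ mc =
          trans (R-moved a c ma mc) (sameLabel-trans g (zone a) (zone b) (zone c)
            (trans (sym (R-moved a b ma mb)) Rab) (trans (sym (R-moved b c mb mc)) Rbc))
        ... | inj₁ oa | inj₂ mb | _ = ⊥-elim (true≢false (trans (sym Rab) (R-mixed a b oa mb)))
        ... | inj₂ ma | inj₁ ob | _ = ⊥-elim (true≢false (trans (sym Rab) (R-mixed′ a b ma ob)))
        ... | _ | inj₁ ob | inj₂ mc = ⊥-elim (true≢false (trans (sym Rbc) (R-mixed b c ob mc)))
        ... | _ | inj₂ mb | inj₁ oc = ⊥-elim (true≢false (trans (sym Rbc) (R-mixed′ b c mb oc)))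

      R-isNC : IsNC n R
      R-isNC = R-isSetPartition , R-isNoncrossing

All-if : ∀ {A : Set} {P : A → Set} b {xs : List A} → All P xs → All P (if b then xs else [])
All-if true ps = ps
All-if false _ = []

τbasis-isNC : ∀ {n k π} → 1 ≤ k → suc k ≤ n → IsNC n π → All (λ p → IsNC n (proj₂ p)) (τbasis n k π)
τbasis-isNC {n} {k} {π} 1≤k k<n ncπ with π k (suc k) in k~k′
... | true = ncπ ∷ []
... | false with ncᵇ n (act k π) in act-nc
...   | true = (act-isSetPartition , ncᵇ-sound n (act k π) act-nc) ∷ []
  where open Transposition 1≤k k<n ncπ
...   | false =
  IsNC-resp-≈ ≈-act-act ncπ ∷ R-isNC g₂ g₂-noncrossing ∷
  ++⁺ (All-if (2 ≤ᵇ companions n ρ (suc k)) (R-isNC g₃ g₃-noncrossing ∷ []))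
          (All-if (2 ≤ᵇ companions n ρ k) (R-isNC g₄ g₄-noncrossing ∷ []))
  where open Transposition 1≤k k<n ncπ
        open Separated k~k′
        open Regrouped

module Linear (n : ℕ) where

  open import Data.Rational using (ℚ; 0ℚ; 1ℚ; _+_; _*_)
  import Data.Rational.Properties as ℚ

  ⟪_⟫ : (Rel → ℚ) → Comb → ℚ
  ⟪ f ⟫ = foldr (λ p acc → proj₁ p * f (proj₂ p) + acc) 0ℚ

  ⟪⟫-++ : ∀ f u v → ⟪ f ⟫ (u ++ v) ≡ ⟪ f ⟫ u + ⟪ f ⟫ v
  ⟪⟫-++ f [] v = sym (ℚ.+-identityˡ _)
  ⟪⟫-++ f ((q , ρ) ∷ u) v = trans (cong (q * f ρ +_) (⟪⟫-++ f u v)) (sym (ℚ.+-assoc (q * f ρ) _ _))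

  ⟪⟫-scale : ∀ f q v → ⟪ f ⟫ (scale q v) ≡ q * ⟪ f ⟫ v
  ⟪⟫-scale f q [] = sym (ℚ.*-zeroʳ q)
  ⟪⟫-scale f q ((r , ρ) ∷ v) =
    trans (cong₂ _+_ (ℚ.*-assoc q r (f ρ)) (⟪⟫-scale f q v)) (sym (ℚ.*-distribˡ-+ q (r * f ρ) _))

  ⟪⟫-τ : ∀ f k v → ⟪ f ⟫ (τ n k v) ≡ ⟪ (λ ρ → ⟪ f ⟫ (τbasis n k ρ)) ⟫ v
  ⟪⟫-τ f k [] = refl
  ⟪⟫-τ f k ((q , ρ) ∷ v) =
    trans (⟪⟫-++ f (scale q (τbasis n k ρ)) (τ n k v)) (cong₂ _+_ (⟪⟫-scale f q (τbasis n k ρ)) (⟪⟫-τ f k v))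

  ⟪⟫-cong : ∀ {P : Rel → Set} f g v → All (λ p → P (proj₂ p)) v → (∀ {ρ} → P ρ → f ρ ≡ g ρ) →
    ⟪ f ⟫ v ≡ ⟪ g ⟫ v
  ⟪⟫-cong f g [] [] _ = refl
  ⟪⟫-cong f g ((q , ρ) ∷ v) (pρ ∷ pv) f≡g = cong₂ (λ a b → q * a + b) (f≡g pρ) (⟪⟫-cong f g v pv f≡g)

  δ : Rel → Rel → ℚ
  δ π ρ = if sameᵇ n ρ π then 1ℚ else 0ℚ

  coeff≡⟪δ⟫ : ∀ v π → coeff n v π ≡ ⟪ δ π ⟫ v
  coeff≡⟪δ⟫ [] π = refl
  coeff≡⟪δ⟫ ((q , ρ) ∷ v) π with sameᵇ n ρ π
  ... | true = cong₂ _+_ (sym (ℚ.*-identityʳ q)) (coeff≡⟪δ⟫ v π)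
  ... | false = trans (coeff≡⟪δ⟫ v π) (sym (trans (cong (_+ ⟪ δ π ⟫ v) (ℚ.*-zeroʳ q)) (ℚ.+-identityˡ _)))

data Pt : Set where
  p₀ p₁ p₂ p₃ : Pt

data Label : Set where
  pt rest : Pt → Label

ptRank : Pt → ℕ
ptRank p₀ = 0
ptRank p₁ = 1
ptRank p₂ = 2
ptRank p₃ = 3

_==ᴸ_ : Label → Label → Bool
pt p ==ᴸ pt q = ptRank p ≡ᵇ ptRank q
rest p ==ᴸ rest q = ptRank p ≡ᵇ ptRank q
_ ==ᴸ _ = false

ptOfRank : ℕ → Pt
ptOfRank 0 = p₀
ptOfRank 1 = p₁
ptOfRank 2 = p₂
ptOfRank _ = p₃

ptOfRank-ptRank : ∀ p → ptOfRank (ptRank p) ≡ p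
ptOfRank-ptRank p₀ = refl
ptOfRank-ptRank p₁ = refl
ptOfRank-ptRank p₂ = refl
ptOfRank-ptRank p₃ = refl

ptRank-injective : ∀ {p q} → ptRank p ≡ ptRank q → p ≡ q
ptRank-injective {p} {q} e = trans (sym (ptOfRank-ptRank p)) (trans (cong ptOfRank e) (ptOfRank-ptRank q))

==ᴸ-refl : ∀ a → (a ==ᴸ a) ≡ true
==ᴸ-refl (pt p) = ≡ᵇ-refl (ptRank p)
==ᴸ-refl (rest p) = ≡ᵇ-refl (ptRank p)

record PtMap (A : Set) : Set where
  constructor ptMap
  field at₀ at₁ at₂ at₃ : A

_!ᴾ_ : ∀ {A} → PtMap A → Pt → A
ptMap a _ _ _ !ᴾ p₀ = a
ptMap _ a _ _ !ᴾ p₁ = a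
ptMap _ _ a _ !ᴾ p₂ = a
ptMap _ _ _ a !ᴾ p₃ = a

tabulateᴾ : ∀ {A} → (Pt → A) → PtMap A
tabulateᴾ f = ptMap (f p₀) (f p₁) (f p₂) (f p₃)

!ᴾ-tabulate : ∀ {A} (f : Pt → A) p → tabulateᴾ f !ᴾ p ≡ f p
!ᴾ-tabulate f p₀ = refl
!ᴾ-tabulate f p₁ = refl
!ᴾ-tabulate f p₂ = refl
!ᴾ-tabulate f p₃ = refl

record LabelMap (A : Set) : Set where
  constructor labelMap
  field atPt atRest : PtMap A

_!_ : ∀ {A} → LabelMap A → Label → A
labelMap m _ ! pt p = m !ᴾ p
labelMap _ m ! rest p = m !ᴾ p

tabulateᴸ : ∀ {A} → (Label → A) → LabelMap A
tabulateᴸ f = labelMap (tabulateᴾ (f ∘ pt)) (tabulateᴾ (f ∘ rest))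

!-tabulate : ∀ {A} (f : Label → A) l → tabulateᴸ f ! l ≡ f l
!-tabulate f (pt p) = !ᴾ-tabulate (f ∘ pt) p
!-tabulate f (rest p) = !ᴾ-tabulate (f ∘ rest) p

LRel : Set
LRel = Label → Label → Bool

Table : Set
Table = LabelMap (LabelMap Bool)

entry : Table → LRel
entry T a b = (T ! a) ! b

table : LRel → Table
table M = tabulateᴸ (λ a → tabulateᴸ (M a))

entry-table : ∀ M a b → entry (table M) a b ≡ M a b
entry-table M a b = trans (cong (_! b) (!-tabulate (tabulateᴸ ∘ M) a)) (!-tabulate (M a) b)

allPt : (Pt → Bool) → Bool
allPt f = f p₀ ∧ f p₁ ∧ f p₂ ∧ f p₃

allPt-sound : ∀ f → allPt f ≡ true → ∀ p → f p ≡ true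
allPt-sound f e p₀ = ∧-true⇒ˡ e
allPt-sound f e p₁ = ∧-true⇒ˡ (∧-true⇒ʳ {f p₀} e)
allPt-sound f e p₂ = ∧-true⇒ˡ (∧-true⇒ʳ {f p₁} (∧-true⇒ʳ {f p₀} e))
allPt-sound f e p₃ = ∧-true⇒ʳ {f p₂} (∧-true⇒ʳ {f p₁} (∧-true⇒ʳ {f p₀} e))

allPt-complete : ∀ f → (∀ p → f p ≡ true) → allPt f ≡ true
allPt-complete f h = ∧-true (h p₀) (∧-true (h p₁) (∧-true (h p₂) (h p₃)))


module LocalModel where

  open import Data.Nat using (_+_)
  open import Data.List.Properties using (map-cong)
  open import Algebra.Properties.CommutativeSemigroup +-commutativeSemigroup using () renaming (interchange to +-interchange)

  data Side : Set where
    sideI sideJ : Side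

  leftPt rightPt : Side → Pt
  leftPt sideI = p₀
  leftPt sideJ = p₂
  rightPt sideI = p₁
  rightPt sideJ = p₃

  swapPt : Side → Pt → Pt
  swapPt sideI p₀ = p₁
  swapPt sideI p₁ = p₀
  swapPt sideJ p₂ = p₃
  swapPt sideJ p₃ = p₂
  swapPt _ p = p

  swapᴸ : Side → Label → Label
  swapᴸ s (pt p) = pt (swapPt s p)
  swapᴸ s (rest p) = rest p

  actᴸ : Side → LRel → LRel
  actᴸ s M a b = M (swapᴸ s a) (swapᴸ s b)

  clsᴸ : Side → LRel → Label → Cls
  clsᴸ s M l =
    if l ==ᴸ pt (leftPt s) then cI else (if l ==ᴸ pt (rightPt s) then cI' else
    (if M (pt (leftPt s)) l then cA else (if M (pt (rightPt s)) l then cB else cO)))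

  regroupᴸ : (Cls → ℕ) → Side → LRel → LRel
  regroupᴸ g s M a b = rejoin g (clsᴸ s M a) (clsᴸ s M b) (M a b)

  Mult : Set
  Mult = Label → ℕ

  labelList : List Label
  labelList = pt p₀ ∷ pt p₁ ∷ pt p₂ ∷ pt p₃ ∷ rest p₀ ∷ rest p₁ ∷ rest p₂ ∷ rest p₃ ∷ []

  sumᴸ : (Label → ℕ) → ℕ
  sumᴸ f = sum (map f labelList)

  companionsᴸ : Mult → LRel → Label → ℕ
  companionsᴸ N M l₀ = sumᴸ (λ l → if M l₀ l ∧ not (l ==ᴸ l₀) then N l else 0)

  sumᴸ-cong : ∀ {f g} → (∀ l → f l ≡ g l) → sumᴸ f ≡ sumᴸ g
  sumᴸ-cong f≡g = cong sum (map-cong f≡g labelList)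

  sumᴸ-+ : ∀ f g → sumᴸ (λ l → f l + g l) ≡ sumᴸ f + sumᴸ g
  sumᴸ-+ f g = go labelList
    where
    go : ∀ ls → sum (map (λ l → f l + g l) ls) ≡ sum (map f ls) + sum (map g ls)
    go [] = refl
    go (l ∷ ls) = trans (cong (f l + g l +_) (go ls)) (+-interchange (f l) (g l) _ _)

  sumᴸ-indicator : ∀ l₀ (F : Label → Bool) →
    sumᴸ (λ l → if (l₀ ==ᴸ l) ∧ F l then 1 else 0) ≡ (if F l₀ then 1 else 0)
  sumᴸ-indicator (pt p₀) F = +-identityʳ _
  sumᴸ-indicator (pt p₁) F = +-identityʳ _
  sumᴸ-indicator (pt p₂) F = +-identityʳ _
  sumᴸ-indicator (pt p₃) F = +-identityʳ _
  sumᴸ-indicator (rest p₀) F = +-identityʳ _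
  sumᴸ-indicator (rest p₁) F = +-identityʳ _
  sumᴸ-indicator (rest p₂) F = +-identityʳ _
  sumᴸ-indicator (rest p₃) F = +-identityʳ _

  _=ᴹ_ : Maybe Label → Label → Bool
  nothing =ᴹ _ = false
  just l =ᴹ l′ = l ==ᴸ l′

  count-by-label : ∀ (g : ℕ → Maybe Label) (F : Label → Bool) xs →
    count (λ x → maybe′ F false (g x)) xs ≡ sumᴸ (λ l → if F l then count (λ x → g x =ᴹ l) xs else 0)
  count-by-label g F [] = sym (sumᴸ-cong {g = λ _ → 0} (λ l → if-same (F l)))
    where
    if-same : ∀ b → (if b then 0 else 0) ≡ 0
    if-same true = refl
    if-same false = refl
  count-by-label g F (x ∷ xs) with g x
  ... | nothing = count-by-label g F xs
  ... | just l₀ = sym (begin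
    sumᴸ (λ l → if F l then (if l₀ ==ᴸ l then suc (c l) else c l) else 0)
      ≡⟨ sumᴸ-cong split ⟩
    sumᴸ (λ l → (if (l₀ ==ᴸ l) ∧ F l then 1 else 0) + (if F l then c l else 0))
      ≡⟨ sumᴸ-+ (λ l → if (l₀ ==ᴸ l) ∧ F l then 1 else 0) (λ l → if F l then c l else 0) ⟩
    sumᴸ (λ l → if (l₀ ==ᴸ l) ∧ F l then 1 else 0) + sumᴸ (λ l → if F l then c l else 0)
      ≡⟨ cong₂ _+_ (sumᴸ-indicator l₀ F) (sym (count-by-label g F xs)) ⟩
    (if F l₀ then 1 else 0) + count (λ x → maybe′ F false (g x)) xs
      ≡⟨ lead (F l₀) ⟩
    (if F l₀ then suc (count (λ x → maybe′ F false (g x)) xs) else count (λ x → maybe′ F false (g x)) xs) ∎)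
    where
    open ≡-Reasoning
    c : Label → ℕ
    c l = count (λ x → g x =ᴹ l) xs
    split : ∀ l → (if F l then (if l₀ ==ᴸ l then suc (c l) else c l) else 0)
                ≡ (if (l₀ ==ᴸ l) ∧ F l then 1 else 0) + (if F l then c l else 0)
    split l with F l | l₀ ==ᴸ l
    ... | true | true = refl
    ... | true | false = refl
    ... | false | true = refl
    ... | false | false = refl
    lead : ∀ b {m} → (if b then 1 else 0) + m ≡ (if b then suc m else m)
    lead true = refl
    lead false = refl

  -- τ tests block sizes only through 1 ≤ _ and 2 ≤ _, so multiplicities capped at 2 suffice.
  cap : ℕ → ℕ
  cap 0 = 0
  cap 1 = 1
  cap (suc (suc _)) = 2

  cap-idem : ∀ m → cap (cap m) ≡ cap m
  cap-idem 0 = refl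
  cap-idem 1 = refl
  cap-idem (suc (suc _)) = refl

  cap-+ : ∀ m m′ → cap (m + m′) ≡ cap (cap m + cap m′)
  cap-+ 0 m′ = sym (cap-idem m′)
  cap-+ 1 0 = refl
  cap-+ 1 1 = refl
  cap-+ 1 (suc (suc _)) = refl
  cap-+ (suc (suc _)) _ = refl

  cap-sumᴸ : ∀ f g → (∀ l → cap (f l) ≡ cap (g l)) → cap (sumᴸ f) ≡ cap (sumᴸ g)
  cap-sumᴸ f g f≈g = go labelList
    where
    go : ∀ ls → cap (sum (map f ls)) ≡ cap (sum (map g ls))
    go [] = refl
    go (l ∷ ls) = trans (cap-+ (f l) _) (trans (cong₂ (λ a b → cap (a + b)) (f≈g l) (go ls)) (sym (cap-+ (g l) _)))

  threshold-cap : ∀ {t} → t ≤ 2 → ∀ m → (t ≤ᵇ m) ≡ (t ≤ᵇ cap m)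
  threshold-cap t≤2 0 = refl
  threshold-cap t≤2 1 = refl
  threshold-cap t≤2 (suc (suc m)) = trans (≤⇒≤ᵇ-true (≤-trans t≤2 (s≤s (s≤s z≤n)))) (sym (≤⇒≤ᵇ-true t≤2))

  -- The sign true stands for the coefficient +1, false for −1.
  Signed : Set
  Signed = List (Bool × Table)

  σᴸ : Side → Mult → Table → Signed
  σᴸ s N T =
    (true , table (actᴸ s (entry T))) ∷ (true , table (regroupᴸ g₂ s (entry T))) ∷
    ((if 2 ≤ᵇ companionsᴸ N (entry T) (pt (rightPt s)) then (false , table (regroupᴸ g₃ s (entry T))) ∷ [] else []) ++
     (if 2 ≤ᵇ companionsᴸ N (entry T) (pt (leftPt s)) then (false , table (regroupᴸ g₄ s (entry T))) ∷ [] else []))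

  τᴸ : Side → Mult → Table → Signed
  τᴸ s N T =
    if entry T (pt (leftPt s)) (pt (rightPt s)) then (false , T) ∷ []
    else (if not ((1 ≤ᵇ companionsᴸ N (entry T) (pt (leftPt s))) ∧ (1 ≤ᵇ companionsᴸ N (entry T) (pt (rightPt s))))
          then (true , table (actᴸ s (entry T))) ∷ []
          else σᴸ s N (table (actᴸ s (entry T))))

  _⇔_ : Bool → Bool → Bool
  a ⇔ b = not (a xor b)

  τᴸ-after : Side → Mult → Signed → Signed
  τᴸ-after s N = concatMap (λ p → map (λ q → (proj₁ p ⇔ proj₁ q , proj₂ q)) (τᴸ s N (proj₂ p)))

  negate : Signed → Signed
  negate = map (λ p → (not (proj₁ p) , proj₂ p))

  inhabited : Mult → Label → Bool
  inhabited N l = 1 ≤ᵇ N l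

  -- Entries at labels carried by no element do not affect the realised partition; clearing them
  -- lets tables that realise the same partition be compared entrywise.
  restrict : Mult → Table → Table
  restrict N T = table (λ a b → inhabited N a ∧ (inhabited N b ∧ entry T a b))

  ptMapEq : ∀ {A : Set} → (A → A → Bool) → PtMap A → PtMap A → Bool
  ptMapEq eq (ptMap a₀ a₁ a₂ a₃) (ptMap b₀ b₁ b₂ b₃) = eq a₀ b₀ ∧ eq a₁ b₁ ∧ eq a₂ b₂ ∧ eq a₃ b₃

  labelMapEq : ∀ {A : Set} → (A → A → Bool) → LabelMap A → LabelMap A → Bool
  labelMapEq eq (labelMap a b) (labelMap c d) = ptMapEq eq a c ∧ ptMapEq eq b d

  tableEq : Table → Table → Bool
  tableEq = labelMapEq (labelMapEq (λ x y → not (x xor y)))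

  ptMapEq-sound : ∀ {A : Set} (eq : A → A → Bool) {P : A → A → Set} → (∀ x y → eq x y ≡ true → P x y) →
    ∀ m m′ → ptMapEq eq m m′ ≡ true → ∀ p → P (m !ᴾ p) (m′ !ᴾ p)
  ptMapEq-sound eq sound (ptMap a₀ _ _ _) (ptMap b₀ _ _ _) e p₀ = sound _ _ (∧-true⇒ˡ e)
  ptMapEq-sound eq sound (ptMap a₀ a₁ _ _) (ptMap b₀ b₁ _ _) e p₁ = sound _ _ (∧-true⇒ˡ (∧-true⇒ʳ {eq a₀ b₀} e))
  ptMapEq-sound eq sound (ptMap a₀ a₁ a₂ _) (ptMap b₀ b₁ b₂ _) e p₂ =
    sound _ _ (∧-true⇒ˡ (∧-true⇒ʳ {eq a₁ b₁} (∧-true⇒ʳ {eq a₀ b₀} e)))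
  ptMapEq-sound eq sound (ptMap a₀ a₁ a₂ a₃) (ptMap b₀ b₁ b₂ b₃) e p₃ =
    sound _ _ (∧-true⇒ʳ {eq a₂ b₂} (∧-true⇒ʳ {eq a₁ b₁} (∧-true⇒ʳ {eq a₀ b₀} e)))

  labelMapEq-sound : ∀ {A : Set} (eq : A → A → Bool) {P : A → A → Set} → (∀ x y → eq x y ≡ true → P x y) →
    ∀ m m′ → labelMapEq eq m m′ ≡ true → ∀ l → P (m ! l) (m′ ! l)
  labelMapEq-sound eq sound (labelMap a b) (labelMap c d) e (pt p) = ptMapEq-sound eq sound a c (∧-true⇒ˡ e) p
  labelMapEq-sound eq sound (labelMap a b) (labelMap c d) e (rest p) =
    ptMapEq-sound eq sound b d (∧-true⇒ʳ {ptMapEq eq a c} e) p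

  tableEq-sound : ∀ T U → tableEq T U ≡ true → ∀ a b → entry T a b ≡ entry U a b
  tableEq-sound = labelMapEq-sound _ (labelMapEq-sound _ bool-sound)
    where
    bool-sound : ∀ x y → not (x xor y) ≡ true → x ≡ y
    bool-sound true true _ = refl
    bool-sound false false _ = refl

  removeOpposite : Bool × Table → Signed → Maybe Signed
  removeOpposite x [] = nothing
  removeOpposite x (y ∷ ys) =
    if (proj₁ x xor proj₁ y) ∧ tableEq (proj₂ x) (proj₂ y) then just ys
    else Data.Maybe.map (y ∷_) (removeOpposite x ys)

  cancel : Signed → Signed
  cancel [] = []
  cancel (x ∷ xs) with removeOpposite x (cancel xs)
  ... | nothing = x ∷ cancel xs
  ... | just ys = ys

  null : Signed → Bool
  null [] = true
  null (_ ∷ _) = false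

  restrictSigned : Mult → Signed → Signed
  restrictSigned N = map (λ p → (proj₁ p , restrict N (proj₂ p)))

  commutesᴸ : Mult → Table → Bool
  commutesᴸ N T =
    null (cancel (restrictSigned N (τᴸ-after sideI N (τᴸ sideJ N T) ++ negate (τᴸ-after sideJ N (τᴸ sideI N T)))))

  record Links : Set where
    constructor links
    field l₀₁ l₀₂ l₀₃ l₁₂ l₁₃ l₂₃ : Bool

  linked : Links → Pt → Pt → Bool
  linked (links l₀₁ _ _ _ _ _) p₀ p₁ = l₀₁
  linked (links _ l₀₂ _ _ _ _) p₀ p₂ = l₀₂
  linked (links _ _ l₀₃ _ _ _) p₀ p₃ = l₀₃
  linked (links _ _ _ l₁₂ _ _) p₁ p₂ = l₁₂
  linked (links _ _ _ _ l₁₃ _) p₁ p₃ = l₁₃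
  linked (links _ _ _ _ _ l₂₃) p₂ p₃ = l₂₃
  linked (links l₀₁ _ _ _ _ _) p₁ p₀ = l₀₁
  linked (links _ l₀₂ _ _ _ _) p₂ p₀ = l₀₂
  linked (links _ _ l₀₃ _ _ _) p₃ p₀ = l₀₃
  linked (links _ _ _ l₁₂ _ _) p₂ p₁ = l₁₂
  linked (links _ _ _ _ l₁₃ _) p₃ p₁ = l₁₃
  linked (links _ _ _ _ _ l₂₃) p₃ p₂ = l₂₃
  linked _ _ _ = true

  anchorPt : Label → Pt
  anchorPt (pt p) = p
  anchorPt (rest p) = p

  linksTable : Links → Table
  linksTable L = table (λ a b → linked L (anchorPt a) (anchorPt b))

  transitiveᴸ : Links → Bool
  transitiveᴸ L = allPt λ p → allPt λ q → allPt λ r → not (linked L p q ∧ linked L q r) ∨ linked L p r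

  data Size : Set where
    none one many : Size

  sizeℕ : Size → ℕ
  sizeℕ none = 0
  sizeℕ one = 1
  sizeℕ many = 2

  capSize : ℕ → Size
  capSize 0 = none
  capSize 1 = one
  capSize (suc (suc _)) = many

  sizeℕ-capSize : ∀ m → sizeℕ (capSize m) ≡ cap m
  sizeℕ-capSize 0 = refl
  sizeℕ-capSize 1 = refl
  sizeℕ-capSize (suc (suc _)) = refl

  mult : PtMap Size → Mult
  mult c (pt _) = 1
  mult c (rest p) = sizeℕ (c !ᴾ p)

  allBool : (Bool → Bool) → Bool
  allBool f = f true ∧ f false

  allSize : (Size → Bool) → Bool
  allSize f = f none ∧ f one ∧ f many

  -- Opaque, so that conversion checking never starts evaluating checkAll.
  opaque
    allLinks : (Links → Bool) → Bool
    allLinks f = allBool λ a → allBool λ b → allBool λ c → allBool λ d → allBool λ e → allBool λ g →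
      f (links a b c d e g)

    allSizes : (PtMap Size → Bool) → Bool
    allSizes f = allSize λ a → allSize λ b → allSize λ c → allSize λ d → f (ptMap a b c d)

  checkAll : Bool
  checkAll = allLinks λ L → not (transitiveᴸ L) ∨ allSizes λ c → commutesᴸ (mult c) (linksTable L)

  allBool-sound : ∀ f → allBool f ≡ true → ∀ b → f b ≡ true
  allBool-sound f e true = ∧-true⇒ˡ e
  allBool-sound f e false = ∧-true⇒ʳ {f true} e

  allSize-sound : ∀ f → allSize f ≡ true → ∀ c → f c ≡ true
  allSize-sound f e none = ∧-true⇒ˡ e
  allSize-sound f e one = ∧-true⇒ˡ (∧-true⇒ʳ {f none} e)
  allSize-sound f e many = ∧-true⇒ʳ {f one} (∧-true⇒ʳ {f none} e)

  opaque
    unfolding allLinks allSizes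

    allLinks-sound : ∀ f → allLinks f ≡ true → ∀ L → f L ≡ true
    allLinks-sound f e (links a b c d g h) =
      allBool-sound (λ h → f (links a b c d g h))
      (allBool-sound (λ g → allBool λ h → f (links a b c d g h))
      (allBool-sound (λ d → allBool λ g → allBool λ h → f (links a b c d g h))
      (allBool-sound (λ c → allBool λ d → allBool λ g → allBool λ h → f (links a b c d g h))
      (allBool-sound (λ b → allBool λ c → allBool λ d → allBool λ g → allBool λ h → f (links a b c d g h))
      (allBool-sound (λ a → allBool λ b → allBool λ c → allBool λ d → allBool λ g → allBool λ h → f (links a b c d g h))
        e a) b) c) d) g) h

    allSizes-sound : ∀ f → allSizes f ≡ true → ∀ c → f c ≡ true
    allSizes-sound f e (ptMap a b c d) =
      allSize-sound (λ d → f (ptMap a b c d))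
      (allSize-sound (λ c → allSize λ d → f (ptMap a b c d))
      (allSize-sound (λ b → allSize λ c → allSize λ d → f (ptMap a b c d))
      (allSize-sound (λ a → allSize λ b → allSize λ c → allSize λ d → f (ptMap a b c d)) e a) b) c) d

    checkAll-true : checkAll ≡ true
    checkAll-true = refl

  configurations-commute : ∀ L → transitiveᴸ L ≡ true → ∀ c → commutesᴸ (mult c) (linksTable L) ≡ true
  configurations-commute L trans-L c =
    allSizes-sound (λ c → commutesᴸ (mult c) (linksTable L))
      (or-elim trans-L (allLinks-sound (λ L → not (transitiveᴸ L) ∨ allSizes λ c → commutesᴸ (mult c) (linksTable L))
                                       checkAll-true L)) c
    where
    or-elim : ∀ {a b} → a ≡ true → not a ∨ b ≡ true → b ≡ true
    or-elim refl e = e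

module Realisation {n i j : ℕ} (1≤i : 1 ≤ i) (i+1<j : suc (suc i) ≤ j) (j<n : suc j ≤ n)
                   {π : Rel} (ncπ : IsNC n π) where

  open Noncrossing ncπ
  open LocalModel

  pos : Pt → ℕ
  pos p₀ = i
  pos p₁ = suc i
  pos p₂ = j
  pos p₃ = suc j

  idx : Side → ℕ
  idx s = pos (leftPt s)

  pos-rightPt : ∀ s → pos (rightPt s) ≡ suc (idx s)
  pos-rightPt sideI = refl
  pos-rightPt sideJ = refl

  i<j : i < j
  i<j = <-trans (n<1+n i) i+1<j

  pos∈ : ∀ p → InN n (pos p)
  pos∈ p₀ = 1≤i , ≤-trans (<⇒≤ (<-trans i<j (n<1+n j))) j<n
  pos∈ p₁ = s≤s z≤n , ≤-trans (<⇒≤ (<-trans i+1<j (n<1+n j))) j<n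
  pos∈ p₂ = ≤-trans 1≤i (<⇒≤ i<j) , <⇒≤ j<n
  pos∈ p₃ = s≤s z≤n , j<n

  anchor : Label → ℕ
  anchor l = pos (anchorPt l)

  restLabel : ℕ → Maybe Label
  restLabel x =
    if π i x then just (rest p₀) else (if π (suc i) x then just (rest p₁) else
    (if π j x then just (rest p₂) else (if π (suc j) x then just (rest p₃) else nothing)))

  data PosView (x : ℕ) : Set where
    at : ∀ p → x ≡ pos p → PosView x
    off : (∀ p → x ≢ pos p) → PosView x

  posView : ∀ x → PosView x
  posView x with x ≟ i | x ≟ suc i | x ≟ j | x ≟ suc j
  ... | yes e | _ | _ | _ = at p₀ e
  ... | no _ | yes e | _ | _ = at p₁ e
  ... | no _ | no _ | yes e | _ = at p₂ e
  ... | no _ | no _ | no _ | yes e = at p₃ e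
  ... | no x≢i | no x≢i′ | no x≢j | no x≢j′ = off λ { p₀ → x≢i ; p₁ → x≢i′ ; p₂ → x≢j ; p₃ → x≢j′ }

  -- Opaque, so that label stays folded in goals and can be rewritten with label-pos and label-off.
  opaque
    label : ℕ → Maybe Label
    label x =
      if x ≡ᵇ i then just (pt p₀) else (if x ≡ᵇ suc i then just (pt p₁) else
      (if x ≡ᵇ j then just (pt p₂) else (if x ≡ᵇ suc j then just (pt p₃) else restLabel x)))

    label-pos : ∀ p → label (pos p) ≡ just (pt p)
    label-pos p₀ rewrite ≡ᵇ-refl i = refl
    label-pos p₁ rewrite ≢⇒≡ᵇ-false (suc≢ i) | ≡ᵇ-refl i = refl
    label-pos p₂ rewrite ≢⇒≡ᵇ-false (<⇒≢ i<j ∘ sym) | ≢⇒≡ᵇ-false (<⇒≢ i+1<j ∘ sym) | ≡ᵇ-refl j = refl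
    label-pos p₃
      rewrite ≢⇒≡ᵇ-false (<⇒≢ (<-trans i<j (n<1+n j)) ∘ sym) | ≢⇒≡ᵇ-false (<⇒≢ (<-trans i+1<j (n<1+n j)) ∘ sym)
            | ≢⇒≡ᵇ-false (suc≢ j) | ≡ᵇ-refl j = refl

    label-off : ∀ {x} → (∀ p → x ≢ pos p) → label x ≡ restLabel x
    label-off off-x
      rewrite ≢⇒≡ᵇ-false (off-x p₀) | ≢⇒≡ᵇ-false (off-x p₁) | ≢⇒≡ᵇ-false (off-x p₂) | ≢⇒≡ᵇ-false (off-x p₃) = refl

  pos-injective : ∀ {p q} → pos p ≡ pos q → p ≡ q
  pos-injective {p} {q} e with trans (sym (label-pos p)) (trans (cong label e) (label-pos q))
  ... | refl = refl

  restLabel-notPt : ∀ x p → (restLabel x =ᴹ pt p) ≡ false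
  restLabel-notPt x p with π i x | π (suc i) x | π j x | π (suc j) x
  ... | true | _ | _ | _ = refl
  ... | false | true | _ | _ = refl
  ... | false | false | true | _ = refl
  ... | false | false | false | true = refl
  ... | false | false | false | false = refl

  ≡ᵇ-pos : ∀ x p → (x ≡ᵇ pos p) ≡ (label x =ᴹ pt p)
  ≡ᵇ-pos x p with posView x
  ... | at q refl rewrite label-pos q = bool-ext
    (λ e → trans (cong (λ r → ptRank r ≡ᵇ ptRank p) (pos-injective (≡ᵇ-true⇒≡ {pos q} e))) (≡ᵇ-refl (ptRank p)))
    (λ e → trans (cong (λ r → pos r ≡ᵇ pos p) (ptRank-injective (≡ᵇ-true⇒≡ {ptRank q} e))) (≡ᵇ-refl (pos p)))
  ... | off off-x rewrite label-off off-x | ≢⇒≡ᵇ-false (off-x p) = sym (restLabel-notPt x p)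

  restLabel-anchored : ∀ x {l} → restLabel x ≡ just l → π (anchor l) x ≡ true
  restLabel-anchored x e with π i x in e₀ | π (suc i) x in e₁ | π j x in e₂ | π (suc j) x in e₃ | e
  ... | true | _ | _ | _ | refl = e₀
  ... | false | true | _ | _ | refl = e₁
  ... | false | false | true | _ | refl = e₂
  ... | false | false | false | true | refl = e₃

  label-anchored : ∀ {x l} → InN n x → label x ≡ just l → π (anchor l) x ≡ true
  label-anchored {x} x∈ e with posView x
  ... | at p refl with trans (sym (label-pos p)) e
  ...   | refl = ~refl x∈
  label-anchored {x} x∈ e | off off-x = restLabel-anchored x (trans (sym (label-off off-x)) e)

  unlabelled⇒off : ∀ {x} → label x ≡ nothing → ∀ p → x ≢ pos p
  unlabelled⇒off {x} e p refl with trans (sym (label-pos p)) e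
  ... | ()

  unlabelled⇒unlinked : ∀ {x} → label x ≡ nothing → ∀ p → π (pos p) x ≡ false
  unlabelled⇒unlinked {x} e
    with π i x in e₀ | π (suc i) x in e₁ | π j x in e₂ | π (suc j) x in e₃ | trans (sym (label-off {x} (unlabelled⇒off e))) e
  ... | false | false | false | false | _ = λ { p₀ → e₀ ; p₁ → e₁ ; p₂ → e₂ ; p₃ → e₃ }

  pos-distinct : ∀ {p q} → p ≢ q → pos p ≢ pos q
  pos-distinct p≢q = p≢q ∘ pos-injective

  glue : LRel → Maybe Label → Maybe Label → Bool → Bool
  glue M (just a) (just b) _ = M a b
  glue M nothing nothing v = v
  glue M _ _ _ = false

  realise : LRel → Rel
  realise M x y = glue M (label x) (label y) (π x y)

  realise-ext : ∀ {M M′} → (∀ a b → M a b ≡ M′ a b) → ∀ x y → realise M x y ≡ realise M′ x y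
  realise-ext M≡M′ x y with label x | label y
  ... | nothing | nothing = refl
  ... | nothing | just _ = refl
  ... | just _ | nothing = refl
  ... | just a | just b = M≡M′ a b

  anchorLinks : LRel
  anchorLinks a b = π (anchor a) (anchor b)

  π≈realise : π ≈[ n ] realise anchorLinks
  π≈realise {x} {y} x∈ y∈ with label x in lx | label y in ly
  ... | nothing | nothing = refl
  ... | nothing | just l =
    ≁-sym y∈ x∈ (≁-resp-~ x∈ y∈ (pos∈ (anchorPt l)) (label-anchored y∈ ly) (unlabelled⇒unlinked lx (anchorPt l)))
  ... | just l | nothing =
    ≁-resp-~ y∈ x∈ (pos∈ (anchorPt l)) (label-anchored x∈ lx) (unlabelled⇒unlinked ly (anchorPt l))
  ... | just a | just b = bool-ext
    (λ xy → ~trans a∈ x∈ b∈ (label-anchored x∈ lx) (~trans x∈ y∈ b∈ xy (~sym b∈ y∈ (label-anchored y∈ ly))))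
    (λ ab → ~trans x∈ a∈ y∈ (~sym a∈ x∈ (label-anchored x∈ lx)) (~trans a∈ b∈ y∈ ab (label-anchored y∈ ly)))
    where
    a∈ : InN n (anchor a)
    a∈ = pos∈ (anchorPt a)
    b∈ : InN n (anchor b)
    b∈ = pos∈ (anchorPt b)

  swp-pos : ∀ s p → swp (idx s) (pos p) ≡ pos (swapPt s p)
  swp-pos sideI p₀ = swp-left i
  swp-pos sideI p₁ = swp-right i
  swp-pos sideI p₂ = swp-other i (pos-distinct {p₂} {p₀} λ ()) (pos-distinct {p₂} {p₁} λ ())
  swp-pos sideI p₃ = swp-other i (pos-distinct {p₃} {p₀} λ ()) (pos-distinct {p₃} {p₁} λ ())
  swp-pos sideJ p₀ = swp-other j (pos-distinct {p₀} {p₂} λ ()) (pos-distinct {p₀} {p₃} λ ())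
  swp-pos sideJ p₁ = swp-other j (pos-distinct {p₁} {p₂} λ ()) (pos-distinct {p₁} {p₃} λ ())
  swp-pos sideJ p₂ = swp-left j
  swp-pos sideJ p₃ = swp-right j

  swp-off : ∀ s {x} → (∀ p → x ≢ pos p) → swp (idx s) x ≡ x
  swp-off s off-x = swp-other (idx s) (off-x (leftPt s)) (λ e → off-x (rightPt s) (trans e (sym (pos-rightPt s))))

  restLabel-unswapped : ∀ s x → Data.Maybe.map (swapᴸ s) (restLabel x) ≡ restLabel x
  restLabel-unswapped s x with π i x | π (suc i) x | π j x | π (suc j) x
  ... | true | _ | _ | _ = refl
  ... | false | true | _ | _ = refl
  ... | false | false | true | _ = refl
  ... | false | false | false | true = refl
  ... | false | false | false | false = refl

  label-swp : ∀ s x → label (swp (idx s) x) ≡ Data.Maybe.map (swapᴸ s) (label x)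
  label-swp s x with posView x
  ... | at p refl rewrite swp-pos s p | label-pos (swapPt s p) | label-pos p = refl
  ... | off off-x rewrite swp-off s off-x | label-off off-x = sym (restLabel-unswapped s x)

  realise-act : ∀ s M x y → act (idx s) (realise M) x y ≡ realise (actᴸ s M) x y
  realise-act s M x y rewrite label-swp s x | label-swp s y with label x in lx | label y in ly
  ... | nothing | nothing =
    cong₂ π (swp-off s (unlabelled⇒off lx)) (swp-off s (unlabelled⇒off ly))
  ... | nothing | just _ = refl
  ... | just _ | nothing = refl
  ... | just _ | just _ = refl

  clsᴹ : Side → LRel → Maybe Label → Cls
  clsᴹ s M nothing = cO
  clsᴹ s M (just l) = clsᴸ s M l

  cls-realise : ∀ s M x → cls (idx s) (realise M) x ≡ clsᴹ s M (label x)
  cls-realise s M x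
    rewrite ≡ᵇ-pos x (leftPt s) | label-pos (leftPt s)
          | subst (λ k → (x ≡ᵇ k) ≡ (label x =ᴹ pt (rightPt s))) (pos-rightPt s) (≡ᵇ-pos x (rightPt s))
          | subst (λ k → label k ≡ just (pt (rightPt s))) (pos-rightPt s) (label-pos (rightPt s))
    with label x
  ... | nothing = refl
  ... | just l = refl

  realise-regroup : ∀ g s M x y → regroup g (idx s) (realise M) x y ≡ realise (regroupᴸ g s M) x y
  realise-regroup g s M x y =
    trans (regroup≡rejoin g (idx s) (realise M) x y)
          (trans (cong₂ (λ c d → rejoin g c d (realise M x y)) (cls-realise s M x) (cls-realise s M y)) glued)
    where
    glued : rejoin g (clsᴹ s M (label x)) (clsᴹ s M (label y)) (realise M x y) ≡ realise (regroupᴸ g s M) x y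
    glued with label x | label y
    ... | nothing | nothing = refl
    ... | nothing | just b = rejoin-unmovedˡ g (clsᴸ s M b) false (λ _ → refl)
    ... | just a | nothing = rejoin-unmovedʳ g (clsᴸ s M a) false (λ _ → refl)
    ... | just a | just b = refl

  realise-table : ∀ M x y → realise (entry (table M)) x y ≡ realise M x y
  realise-table M x y with label x | label y
  ... | nothing | nothing = refl
  ... | nothing | just _ = refl
  ... | just _ | nothing = refl
  ... | just a | just b = entry-table M a b

  realise-pos : ∀ M p q → realise M (pos p) (pos q) ≡ M (pt p) (pt q)
  realise-pos M p q rewrite label-pos p | label-pos q = refl

  multiplicity : Label → ℕ
  multiplicity l = count (λ x → label x =ᴹ l) (range n)

  multiplicity-pt : ∀ p → multiplicity (pt p) ≡ 1
  multiplicity-pt p = trans (count-cong _ _ (range n) (λ {x} _ → sym (≡ᵇ-pos x p)))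
                            (count-≡ᵇ-unique (range-unique n) (∈-range⁺ (pos∈ p)))

  sizes : PtMap Size
  sizes = tabulateᴾ (λ p → capSize (multiplicity (rest p)))

  cap-mult : ∀ l → cap (mult sizes l) ≡ cap (multiplicity l)
  cap-mult (pt p) rewrite multiplicity-pt p = refl
  cap-mult (rest p) rewrite !ᴾ-tabulate (λ p → capSize (multiplicity (rest p))) p
                          | sizeℕ-capSize (multiplicity (rest p)) = cap-idem (multiplicity (rest p))

  labelled-inhabited : ∀ {x l} → InN n x → label x ≡ just l → inhabited (mult sizes) l ≡ true
  labelled-inhabited {x} {l} x∈ lx =
    begin
      1 ≤ᵇ mult sizes l              ≡⟨ threshold-cap (s≤s z≤n) (mult sizes l) ⟩
      1 ≤ᵇ cap (mult sizes l)        ≡⟨ cong (1 ≤ᵇ_) (cap-mult l) ⟩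
      1 ≤ᵇ cap (multiplicity l)      ≡⟨ threshold-cap (s≤s z≤n) (multiplicity l) ⟨
      1 ≤ᵇ multiplicity l            ≡⟨ ≤⇒≤ᵇ-true (witness⇒count-pos _ (∈-range⁺ x∈) labelled) ⟩
      true                           ∎
    where
    open ≡-Reasoning
    labelled : (label x =ᴹ l) ≡ true
    labelled rewrite lx = ==ᴸ-refl l

  companions-realise : ∀ M p →
    companions n (realise M) (pos p) ≡ sumᴸ (λ l → if M (pt p) l ∧ not (l ==ᴸ pt p) then multiplicity l else 0)
  companions-realise M p =
    trans (count-cong _ _ (range n) (λ {x} _ → glued x))
          (count-by-label label (λ l → M (pt p) l ∧ not (l ==ᴸ pt p)) (range n))
    where
    glued : ∀ x → (realise M (pos p) x ∧ not (x ≡ᵇ pos p)) ≡ maybe′ (λ l → M (pt p) l ∧ not (l ==ᴸ pt p)) false (label x)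
    glued x rewrite label-pos p | ≡ᵇ-pos x p with label x
    ... | nothing = refl
    ... | just l = refl

  companions-threshold : ∀ {t} → t ≤ 2 → ∀ {R} M p → R ≈[ n ] realise M →
    (t ≤ᵇ companions n R (pos p)) ≡ (t ≤ᵇ companionsᴸ (mult sizes) M (pt p))
  companions-threshold {t} t≤2 {R} M p R≈M =
    begin
      t ≤ᵇ companions n R (pos p)
        ≡⟨ cong (t ≤ᵇ_) (count-cong _ _ (range n) (λ x∈ → cong (_∧ _) (R≈M (pos∈ p) (∈-range⁻ x∈)))) ⟩
      t ≤ᵇ companions n (realise M) (pos p)
        ≡⟨ cong (t ≤ᵇ_) (companions-realise M p) ⟩
      t ≤ᵇ sumᴸ (λ l → if M (pt p) l ∧ not (l ==ᴸ pt p) then multiplicity l else 0)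
        ≡⟨ threshold-cap t≤2 _ ⟩
      t ≤ᵇ cap (sumᴸ (λ l → if M (pt p) l ∧ not (l ==ᴸ pt p) then multiplicity l else 0))
        ≡⟨ cong (t ≤ᵇ_) (cap-sumᴸ _ _ λ l → cap-if (M (pt p) l ∧ not (l ==ᴸ pt p)) (sym (cap-mult l))) ⟩
      t ≤ᵇ cap (companionsᴸ (mult sizes) M (pt p))
        ≡⟨ threshold-cap t≤2 _ ⟨
      t ≤ᵇ companionsᴸ (mult sizes) M (pt p) ∎
    where
    open ≡-Reasoning
    cap-if : ∀ b {m m′} → cap m ≡ cap m′ → cap (if b then m else 0) ≡ cap (if b then m′ else 0)
    cap-if true e = e
    cap-if false _ = refl

module BasisCommutation {n i j : ℕ} (1≤i : 1 ≤ i) (i+1<j : suc (suc i) ≤ j) (j<n : suc j ≤ n) where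

  open import Data.Rational using (ℚ; 0ℚ; 1ℚ; -_; _+_; _*_)
  import Data.Rational.Properties as ℚ
  open import Data.List.Relation.Binary.Pointwise as Pointwise using (Pointwise; []; _∷_)
  open import Data.List.Properties using (map-++)
  import Algebra.Bundles
  open LocalModel
  open Linear n

  signᵠ : Bool → ℚ
  signᵠ true = 1ℚ
  signᵠ false = - 1ℚ

  signᵠ-⇔ : ∀ b b′ → signᵠ (b ⇔ b′) ≡ signᵠ b * signᵠ b′
  signᵠ-⇔ true true = refl
  signᵠ-⇔ true false = refl
  signᵠ-⇔ false true = refl
  signᵠ-⇔ false false = refl

  signᵠ-not : ∀ b → signᵠ (not b) ≡ - signᵠ b
  signᵠ-not true = refl
  signᵠ-not false = refl

  Invariant : (Rel → ℚ) → Set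
  Invariant f = ∀ {ρ ρ′} → ρ ≈[ n ] ρ′ → f ρ ≡ f ρ′

  δ-invariant : ∀ π′ → Invariant (δ π′)
  δ-invariant π′ ρ≈ρ′ = cong (λ b → if b then 1ℚ else 0ℚ)
    (all-cong _ _ (range n) λ x∈ → all-cong _ _ (range n) λ y∈ →
      cong (λ b → not (b xor _)) (ρ≈ρ′ (∈-range⁻ x∈) (∈-range⁻ y∈)))

  module _ {π : Rel} (ncπ : IsNC n π) where

    open Noncrossing ncπ
    open Realisation 1≤i i+1<j j<n ncπ

    embed : Signed → Comb
    embed = map (λ p → (signᵠ (proj₁ p) , realise (entry (proj₂ p))))

    Corresponds : Comb → Signed → Set
    Corresponds = Pointwise (λ p q → proj₁ p ≡ signᵠ (proj₁ q) × proj₂ p ≈[ n ] realise (entry (proj₂ q)))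

    N : Mult
    N = mult sizes

    ~flip : ∀ p q → π (pos p) (pos q) ≡ π (pos q) (pos p)
    ~flip p q = bool-ext (~sym (pos∈ p) (pos∈ q)) (~sym (pos∈ q) (pos∈ p))

    act-corresponds : ∀ s {ρ T} → ρ ≈[ n ] realise (entry T) →
      act (idx s) ρ ≈[ n ] realise (entry (table (actᴸ s (entry T))))
    act-corresponds s {ρ} {T} ρ≈T x∈ y∈ =
      trans (act-resp-≈ (proj₁ (pos∈ (leftPt s))) (subst (_≤ n) (pos-rightPt s) (proj₂ (pos∈ (rightPt s)))) ρ≈T x∈ y∈)
            (trans (realise-act s (entry T) _ _) (sym (realise-table (actᴸ s (entry T)) _ _)))

    regroup-corresponds : ∀ g s {ρ T} → ρ ≈[ n ] realise (entry T) →
      regroup g (idx s) ρ ≈[ n ] realise (entry (table (regroupᴸ g s (entry T))))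
    regroup-corresponds g s {ρ} {T} ρ≈T x∈ y∈ =
      trans (regroup-resp-≈ g (pos∈ (leftPt s)) (subst (InN n) (pos-rightPt s) (pos∈ (rightPt s))) ρ≈T x∈ y∈)
            (trans (realise-regroup g s (entry T) _ _) (sym (realise-table (regroupᴸ g s (entry T)) _ _)))

    corresponds-if : ∀ {b b′ L S} → b ≡ b′ → Corresponds L S →
      Corresponds (if b then L else []) (if b′ then S else [])
    corresponds-if {true} refl c = c
    corresponds-if {false} refl _ = []

    threshold : ∀ {t} → t ≤ 2 → ∀ s {ρ T} → ρ ≈[ n ] realise (entry T) →
      (t ≤ᵇ companions n ρ (idx s)) ≡ (t ≤ᵇ companionsᴸ N (entry T) (pt (leftPt s))) ×
      (t ≤ᵇ companions n ρ (suc (idx s))) ≡ (t ≤ᵇ companionsᴸ N (entry T) (pt (rightPt s)))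
    threshold {t} t≤2 s {ρ} {T} ρ≈T =
      companions-threshold t≤2 (entry T) (leftPt s) ρ≈T ,
      subst (λ k → (t ≤ᵇ companions n ρ k) ≡ (t ≤ᵇ companionsᴸ N (entry T) (pt (rightPt s))))
            (pos-rightPt s) (companions-threshold t≤2 (entry T) (rightPt s) ρ≈T)

    σ-corresponds : ∀ s {ρ T} → ρ ≈[ n ] realise (entry T) → Corresponds (σ n (idx s) ρ) (σᴸ s N T)
    σ-corresponds s ρ≈T =
      (refl , act-corresponds s ρ≈T) ∷ (refl , regroup-corresponds g₂ s ρ≈T) ∷
      Pointwise.++⁺ (corresponds-if (proj₂ (threshold ≤-refl s ρ≈T)) ((refl , regroup-corresponds g₃ s ρ≈T) ∷ []))
                    (corresponds-if (proj₁ (threshold ≤-refl s ρ≈T)) ((refl , regroup-corresponds g₄ s ρ≈T) ∷ []))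

    corresponds-ite : ∀ {b b′ A A′ B B′} → b ≡ b′ →
      (b′ ≡ true → Corresponds A A′) → (b′ ≡ false → Corresponds B B′) →
      Corresponds (if b then A else B) (if b′ then A′ else B′)
    corresponds-ite {true} refl c _ = c refl
    corresponds-ite {false} refl _ c = c refl

    τ-corresponds : ∀ s {ρ T} → IsNC n ρ → ρ ≈[ n ] realise (entry T) → Corresponds (τbasis n (idx s) ρ) (τᴸ s N T)
    τ-corresponds s {ρ} {T} ncρ ρ≈T =
      corresponds-ite link (λ _ → (refl , ρ≈T) ∷ []) λ unlinked →
        corresponds-ite (criterion (trans link unlinked)) (λ _ → (refl , act-corresponds s ρ≈T) ∷ [])
          (λ _ → σ-corresponds s (act-corresponds s ρ≈T))
      where
      k∈ : InN n (idx s)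
      k∈ = pos∈ (leftPt s)
      k′∈ : InN n (suc (idx s))
      k′∈ = subst (InN n) (pos-rightPt s) (pos∈ (rightPt s))
      link : ρ (idx s) (suc (idx s)) ≡ entry T (pt (leftPt s)) (pt (rightPt s))
      link = trans (ρ≈T k∈ k′∈) (subst (λ k → realise (entry T) (idx s) k ≡ entry T (pt (leftPt s)) (pt (rightPt s)))
                                       (pos-rightPt s) (realise-pos (entry T) (leftPt s) (rightPt s)))
      criterion : ρ (idx s) (suc (idx s)) ≡ false →
        ncᵇ n (act (idx s) ρ) ≡ not ((1 ≤ᵇ companionsᴸ N (entry T) (pt (leftPt s))) ∧
                                     (1 ≤ᵇ companionsᴸ N (entry T) (pt (rightPt s))))
      criterion k≁k′ =
        trans (Transposition.Separated.act-ncᵇ (proj₁ k∈) (proj₂ k′∈) ncρ k≁k′)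
              (cong₂ (λ a b → not (a ∧ b)) (proj₁ (threshold (s≤s z≤n) s ρ≈T)) (proj₂ (threshold (s≤s z≤n) s ρ≈T)))

    ⟪⟫-corresponds : ∀ {f} → Invariant f → ∀ {L S} → Corresponds L S → ⟪ f ⟫ L ≡ ⟪ f ⟫ (embed S)
    ⟪⟫-corresponds inv [] = refl
    ⟪⟫-corresponds inv ((q≡ , ρ≈) ∷ c) = cong₂ _+_ (cong₂ _*_ q≡ (inv ρ≈)) (⟪⟫-corresponds inv c)

    ⟪⟫-embed-signed : ∀ f b U →
      ⟪ f ⟫ (embed (map (λ q → (b ⇔ proj₁ q , proj₂ q)) U)) ≡ signᵠ b * ⟪ f ⟫ (embed U)
    ⟪⟫-embed-signed f b U = trans (cong ⟪ f ⟫ (pointwise U)) (⟪⟫-scale f (signᵠ b) (embed U))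
      where
      pointwise : ∀ U → embed (map (λ q → (b ⇔ proj₁ q , proj₂ q)) U) ≡ scale (signᵠ b) (embed U)
      pointwise [] = refl
      pointwise ((b′ , T) ∷ U) = cong₂ _∷_ (cong (_, realise (entry T)) (signᵠ-⇔ b b′)) (pointwise U)

    ⟪⟫-after : ∀ s {f} → Invariant f → ∀ {L S} → Corresponds L S → All (λ p → IsNC n (proj₂ p)) L →
      ⟪ (λ ρ → ⟪ f ⟫ (τbasis n (idx s) ρ)) ⟫ L ≡ ⟪ f ⟫ (embed (τᴸ-after s N S))
    ⟪⟫-after s inv [] [] = refl
    ⟪⟫-after s {f} inv {(q , ρ) ∷ L} {(b , T) ∷ S} ((q≡ , ρ≈T) ∷ c) (ncρ ∷ nc) =
      begin
        q * ⟪ f ⟫ (τbasis n (idx s) ρ) + ⟪ (λ ρ → ⟪ f ⟫ (τbasis n (idx s) ρ)) ⟫ L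
          ≡⟨ cong₂ _+_ (cong₂ _*_ q≡ (⟪⟫-corresponds inv (τ-corresponds s ncρ ρ≈T))) (⟪⟫-after s inv c nc) ⟩
        signᵠ b * ⟪ f ⟫ (embed (τᴸ s N T)) + ⟪ f ⟫ (embed (τᴸ-after s N S))
          ≡⟨ cong (_+ ⟪ f ⟫ (embed (τᴸ-after s N S))) (⟪⟫-embed-signed f b (τᴸ s N T)) ⟨
        ⟪ f ⟫ (embed signedHead) + ⟪ f ⟫ (embed (τᴸ-after s N S))
          ≡⟨ ⟪⟫-++ f (embed signedHead) (embed (τᴸ-after s N S)) ⟨
        ⟪ f ⟫ (embed signedHead ++ embed (τᴸ-after s N S))
          ≡⟨ cong ⟪ f ⟫ (map-++ _ signedHead (τᴸ-after s N S)) ⟨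
        ⟪ f ⟫ (embed (τᴸ-after s N ((b , T) ∷ S))) ∎
      where
      open ≡-Reasoning
      signedHead : Signed
      signedHead = map (λ q → (b ⇔ proj₁ q , proj₂ q)) (τᴸ s N T)

    realise-tableEq : ∀ {T U} → tableEq T U ≡ true → realise (entry T) ≈[ n ] realise (entry U)
    realise-tableEq {T} {U} e {x} {y} _ _ with label x | label y
    ... | nothing | nothing = refl
    ... | nothing | just _ = refl
    ... | just _ | nothing = refl
    ... | just a | just b = tableEq-sound T U e a b

    realise-restrict : ∀ T → realise (entry (restrict N T)) ≈[ n ] realise (entry T)
    realise-restrict T {x} {y} x∈ y∈ with label x in lx | label y in ly
    ... | nothing | nothing = refl
    ... | nothing | just _ = refl
    ... | just _ | nothing = refl
    ... | just a | just b
      rewrite entry-table (λ a b → inhabited N a ∧ (inhabited N b ∧ entry T a b)) a b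
            | labelled-inhabited x∈ lx | labelled-inhabited y∈ ly = refl

    value : (Rel → ℚ) → Bool × Table → ℚ
    value f (b , T) = signᵠ b * f (realise (entry T))

    opposite-value : ∀ {f} → Invariant f → ∀ x y → ((proj₁ x xor proj₁ y) ∧ tableEq (proj₂ x) (proj₂ y)) ≡ true →
      value f y ≡ - value f x
    opposite-value {f} inv (b , T) (b′ , U) e
      rewrite xor-true⇒≡not b b′ (∧-true⇒ˡ e) | inv (realise-tableEq {T} {U} (∧-true⇒ʳ {b xor b′} e)) =
      trans (cong (_* f (realise (entry U))) (signᵠ-not b)) (sym (ℚ.neg-distribˡ-* (signᵠ b) _))

    module _ {f : Rel → ℚ} (inv : Invariant f) where

      open import Algebra.Properties.Group ℚ.+-0-group using (\\-leftDividesˡ; x∙y⁻¹≈ε⇒x≈y)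
      open import Algebra.Properties.CommutativeSemigroup
        (Algebra.Bundles.CommutativeMonoid.commutativeSemigroup ℚ.+-0-commutativeMonoid) using (x∙yz≈y∙xz)

      removeOpposite-value : ∀ x ys {zs} → removeOpposite x ys ≡ just zs →
        ⟪ f ⟫ (embed ys) ≡ - value f x + ⟪ f ⟫ (embed zs)
      removeOpposite-value x (y ∷ ys) e with (proj₁ x xor proj₁ y) ∧ tableEq (proj₂ x) (proj₂ y) in opp
      ... | true with e
      ...   | refl = cong (_+ ⟪ f ⟫ (embed ys)) (opposite-value inv x y opp)
      removeOpposite-value x (y ∷ ys) e | false with removeOpposite x ys in rest
      ...   | just zs′ with e
      ...     | refl = trans (cong (value f y +_) (removeOpposite-value x ys rest))
                             (x∙yz≈y∙xz (value f y) (- value f x) (⟪ f ⟫ (embed zs′)))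

      cancel-value : ∀ S → ⟪ f ⟫ (embed (cancel S)) ≡ ⟪ f ⟫ (embed S)
      cancel-value [] = refl
      cancel-value (x ∷ xs) with removeOpposite x (cancel xs) in removed
      ... | nothing = cong (value f x +_) (cancel-value xs)
      ... | just ys = sym (begin
        value f x + ⟪ f ⟫ (embed xs)                  ≡⟨ cong (value f x +_) (cancel-value xs) ⟨
        value f x + ⟪ f ⟫ (embed (cancel xs))         ≡⟨ cong (value f x +_) (removeOpposite-value x (cancel xs) removed) ⟩
        value f x + (- value f x + ⟪ f ⟫ (embed ys))  ≡⟨ \\-leftDividesˡ (value f x) _ ⟩
        ⟪ f ⟫ (embed ys)                              ∎)
        where open ≡-Reasoning

      negate-value : ∀ S → ⟪ f ⟫ (embed (negate S)) ≡ - ⟪ f ⟫ (embed S)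
      negate-value [] = refl
      negate-value ((b , T) ∷ S) =
        trans (cong₂ _+_ (trans (cong (_* f (realise (entry T))) (signᵠ-not b)) (sym (ℚ.neg-distribˡ-* (signᵠ b) _)))
                         (negate-value S))
              (sym (ℚ.neg-distrib-+ (value f (b , T)) _))

      restrict-value : ∀ S → ⟪ f ⟫ (embed (restrictSigned N S)) ≡ ⟪ f ⟫ (embed S)
      restrict-value [] = refl
      restrict-value ((b , T) ∷ S) = cong₂ (λ u v → signᵠ b * u + v) (inv (realise-restrict T)) (restrict-value S)

      commutes-value : ∀ T → commutesᴸ N T ≡ true →
        ⟪ f ⟫ (embed (τᴸ-after sideI N (τᴸ sideJ N T))) ≡ ⟪ f ⟫ (embed (τᴸ-after sideJ N (τᴸ sideI N T)))
      commutes-value T ok = x∙y⁻¹≈ε⇒x≈y _ _ (begin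
        ⟪ f ⟫ (embed A) + - ⟪ f ⟫ (embed B)
          ≡⟨ cong (⟪ f ⟫ (embed A) +_) (negate-value B) ⟨
        ⟪ f ⟫ (embed A) + ⟪ f ⟫ (embed (negate B))
          ≡⟨ ⟪⟫-++ f (embed A) (embed (negate B)) ⟨
        ⟪ f ⟫ (embed A ++ embed (negate B))
          ≡⟨ cong ⟪ f ⟫ (map-++ _ A (negate B)) ⟨
        ⟪ f ⟫ (embed (A ++ negate B))
          ≡⟨ restrict-value (A ++ negate B) ⟨
        ⟪ f ⟫ (embed (restrictSigned N (A ++ negate B)))
          ≡⟨ cancel-value (restrictSigned N (A ++ negate B)) ⟨
        ⟪ f ⟫ (embed (cancel (restrictSigned N (A ++ negate B))))
          ≡⟨ cong (⟪ f ⟫ ∘ embed) (null⇒[] _ ok) ⟩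
        0ℚ ∎)
        where
        open ≡-Reasoning
        A B : Signed
        A = τᴸ-after sideI N (τᴸ sideJ N T)
        B = τᴸ-after sideJ N (τᴸ sideI N T)
        null⇒[] : ∀ S → null S ≡ true → S ≡ []
        null⇒[] [] _ = refl

    πLinks : Links
    πLinks = links (π i (suc i)) (π i j) (π i (suc j)) (π (suc i) j) (π (suc i) (suc j)) (π j (suc j))

    π-linked : ∀ p q → π (pos p) (pos q) ≡ linked πLinks p q
    π-linked p₀ p₀ = ~refl (pos∈ p₀)
    π-linked p₁ p₁ = ~refl (pos∈ p₁)
    π-linked p₂ p₂ = ~refl (pos∈ p₂)
    π-linked p₃ p₃ = ~refl (pos∈ p₃)
    π-linked p₀ p₁ = refl
    π-linked p₀ p₂ = refl
    π-linked p₀ p₃ = refl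
    π-linked p₁ p₂ = refl
    π-linked p₁ p₃ = refl
    π-linked p₂ p₃ = refl
    π-linked p₁ p₀ = ~flip p₁ p₀
    π-linked p₂ p₀ = ~flip p₂ p₀
    π-linked p₃ p₀ = ~flip p₃ p₀
    π-linked p₂ p₁ = ~flip p₂ p₁
    π-linked p₃ p₁ = ~flip p₃ p₁
    π-linked p₃ p₂ = ~flip p₃ p₂

    πLinks-transitive : transitiveᴸ πLinks ≡ true
    πLinks-transitive =
      allPt-complete _ λ p → allPt-complete _ λ q → allPt-complete _ λ r →
        implication (λ pq qr → subst (_≡ true) (π-linked p r)
          (~trans (pos∈ p) (pos∈ q) (pos∈ r) (trans (π-linked p q) pq) (trans (π-linked q r) qr)))
      where
      implication : ∀ {a b c} → (a ≡ true → b ≡ true → c ≡ true) → not (a ∧ b) ∨ c ≡ true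
      implication {true} {true} h = h refl refl
      implication {true} {false} _ = refl
      implication {false} _ = refl

    T₀ : Table
    T₀ = linksTable πLinks

    π≈T₀ : π ≈[ n ] realise (entry T₀)
    π≈T₀ {x} {y} x∈ y∈ = trans (π≈realise x∈ y∈) (realise-ext anchors x y)
      where
      anchors : ∀ a b → anchorLinks a b ≡ entry T₀ a b
      anchors a b = trans (π-linked (anchorPt a) (anchorPt b))
                          (sym (entry-table (λ a b → linked πLinks (anchorPt a) (anchorPt b)) a b))

    basis-commutes : ∀ π′ → ⟪ (λ ρ → ⟪ δ π′ ⟫ (τbasis n i ρ)) ⟫ (τbasis n j π)
                          ≡ ⟪ (λ ρ → ⟪ δ π′ ⟫ (τbasis n j ρ)) ⟫ (τbasis n i π)
    basis-commutes π′ =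
      begin
        ⟪ (λ ρ → ⟪ δ π′ ⟫ (τbasis n i ρ)) ⟫ (τbasis n j π)
          ≡⟨ ⟪⟫-after sideI inv (τ-corresponds sideJ ncπ π≈T₀) (τbasis-isNC (proj₁ (pos∈ p₂)) j<n ncπ) ⟩
        ⟪ δ π′ ⟫ (embed (τᴸ-after sideI N (τᴸ sideJ N T₀)))
          ≡⟨ commutes-value inv T₀ (configurations-commute πLinks πLinks-transitive sizes) ⟩
        ⟪ δ π′ ⟫ (embed (τᴸ-after sideJ N (τᴸ sideI N T₀)))
          ≡⟨ ⟪⟫-after sideJ inv (τ-corresponds sideI ncπ π≈T₀) (τbasis-isNC 1≤i (proj₂ (pos∈ p₁)) ncπ) ⟨
        ⟪ (λ ρ → ⟪ δ π′ ⟫ (τbasis n j ρ)) ⟫ (τbasis n i π) ∎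
      where
      open ≡-Reasoning
      inv : Invariant (δ π′)
      inv = δ-invariant π′

below-last : ∀ {n j} → 1 ≤ j → j ≤ n ∸ 1 → suc j ≤ n
below-last {suc n} _ j≤n = s≤s j≤n
below-last {zero} {suc j} _ ()

lemma4p2 : (n i j : ℕ) → 1 ≤ i → i < j → j ≤ n ∸ 1 → 1 < j ∸ i →
    (v : Comb) → All (λ p → IsNC n (proj₂ p)) v →
    (π : Rel) → coeff n (τ n i (τ n j v)) π ≡ coeff n (τ n j (τ n i v)) π
lemma4p2 n i j 1≤i i<j j≤n-1 1<j-i v ncv π =
  begin
    coeff n (τ n i (τ n j v)) π
      ≡⟨ coeff≡⟪δ⟫ (τ n i (τ n j v)) π ⟩
    ⟪ δ π ⟫ (τ n i (τ n j v))
      ≡⟨ ⟪⟫-τ (δ π) i (τ n j v) ⟩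
    ⟪ (λ ρ → ⟪ δ π ⟫ (τbasis n i ρ)) ⟫ (τ n j v)
      ≡⟨ ⟪⟫-τ (λ ρ → ⟪ δ π ⟫ (τbasis n i ρ)) j v ⟩
    ⟪ τi∘τj ⟫ v
      ≡⟨ ⟪⟫-cong τi∘τj τj∘τi v ncv (λ ncρ → basis-commutes 1≤i i+1<j j<n ncρ π) ⟩
    ⟪ τj∘τi ⟫ v
      ≡⟨ ⟪⟫-τ (λ ρ → ⟪ δ π ⟫ (τbasis n j ρ)) i v ⟨
    ⟪ (λ ρ → ⟪ δ π ⟫ (τbasis n j ρ)) ⟫ (τ n i v)
      ≡⟨ ⟪⟫-τ (δ π) j (τ n i v) ⟨
    ⟪ δ π ⟫ (τ n j (τ n i v))
      ≡⟨ coeff≡⟪δ⟫ (τ n j (τ n i v)) π ⟨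
    coeff n (τ n j (τ n i v)) π ∎
  where
  open ≡-Reasoning
  open Linear n
  open BasisCommutation using (basis-commutes)
  i+1<j : suc (suc i) ≤ j
  i+1<j = m≤o∸n⇒m+n≤o 2 (<⇒≤ i<j) 1<j-i
  j<n : suc j ≤ n
  j<n = below-last (≤-trans 1≤i (<⇒≤ i<j)) j≤n-1
  τi∘τj τj∘τi : Rel → ℚ
  τi∘τj ρ = ⟪ (λ ρ′ → ⟪ δ π ⟫ (τbasis n i ρ′)) ⟫ (τbasis n j ρ)
  τj∘τi ρ = ⟪ (λ ρ′ → ⟪ δ π ⟫ (τbasis n j ρ′)) ⟫ (τbasis n i ρ)
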